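{- Assume the ABC conjecture. Let $f(x)\in\mathbb{Q}[x]$ be a polynomial of degree $d\ge 2$ which is not a monomial and has at least two distinct roots. Fix a non-zero integer $b$ and positive integers $A_1,\dots,A_r$. Then the equation $$b\,n_1!!\,A_1^{n_1}\cdots n_r!!\,A_r^{n_r}=f(x)$$ has only finitely many solutions $(x,n_1,\dots,n_r)$ with $x\in\mathbb{Z}$ and $n_1,\dots,n_r$ positive integers.
   Context: For a positive integer $m$, the double factorial $m!!$ is the product of all positive integers $\le m$ having the same parity as $m$, i.e. $m!!=m(m-2)(m-4)\cdots$, ending in $1$ if $m$ is odd and in $2$ if $m$ is even. For a non-zero integer $a$, its radical is $N(a)=\prod_{p\mid a}p$ (product over primes dividing $a$). The ABC conjecture: for every $\epsilon>0$ there is a constant $K(\epsilon)$ depending only on $\epsilon$ such that whenever $A,B,C$ are pairwise coprime non-zero integers with $A+B=C$, one has $\max\{|A|,|B|,|C|\}<K(\epsilon)\,N(ABC)^{1+\epsilon}$. -}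

module Defs where

open import Data.Nat as ℕ using (ℕ; zero; suc; _+_; _*_; _^_; _⊔_; _≤_; _<_)
open import Data.Nat.Divisibility using (_∣_; _∣?_)
open import Data.Nat.Primality using (Prime; prime?)
open import Data.Nat.Coprimality using (Coprime)
open import Data.Integer as ℤ using (ℤ; ∣_∣)
open import Data.Rational as ℚ using (ℚ; 0ℚ; 1ℚ)
open import Data.List as List using (List; filter; upTo)
open import Data.Nat.ListAction using (product)
open import Data.Vec as Vec using (Vec; []; _∷_; zipWith; lookup)
open import Data.Fin using (Fin)
open import Data.Product using (_×_; ∃; ∃-syntax; _,_)
open import Relation.Nullary using (¬_)
open import Relation.Nullary.Decidable using (_×-dec_)
open import Relation.Binary.PropositionalEquality using (_≡_; _≢_)

_!! : ℕ → ℕ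
zero !! = 1
suc zero !! = 1
suc (suc n) !! = suc (suc n) * (n !!)

rad : ℕ → ℕ
rad n = product (filter (λ p → prime? p ×-dec (p ∣? n)) (upTo (suc n)))

N : ℤ → ℕ
N a = rad ∣ a ∣

-- The ABC conjecture.  ε ranges over positive rationals p/q (q > 0), which is
-- equivalent to all real ε > 0 by monotonicity in ε; the real constant K(ε)
-- is replaced by the natural constant K ≥ K(ε)^q, and
-- max < K(ε) N^{1+p/q}  is raised to the q-th power:  max^q < K N^{q+p}.
ABC : Set
ABC = (p q : ℕ) → 0 < p → 0 < q →
  ∃[ K ] ((A B C : ℤ) →
    A ≢ ℤ.0ℤ → B ≢ ℤ.0ℤ → C ≢ ℤ.0ℤ →
    Coprime ∣ A ∣ ∣ B ∣ → Coprime ∣ A ∣ ∣ C ∣ → Coprime ∣ B ∣ ∣ C ∣ →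
    A ℤ.+ B ≡ C →
    (∣ A ∣ ⊔ ∣ B ∣ ⊔ ∣ C ∣) ^ q < K * N (A ℤ.* B ℤ.* C) ^ (q + p))

_^ℚ_ : ℚ → ℕ → ℚ
x ^ℚ zero = 1ℚ
x ^ℚ suc n = x ℚ.* (x ^ℚ n)

-- polynomials over ℚ of degree ≤ d: coefficient vector (a₀, a₁, …, a_d), lowest first
Poly : ℕ → Set
Poly d = Vec ℚ (suc d)

evalList : ∀ {n} → Vec ℚ n → ℚ → ℚ
evalList [] x = 0ℚ
evalList (a ∷ as) x = a ℚ.+ x ℚ.* evalList as x

eval : ∀ {d} → Poly d → ℚ → ℚ
eval = evalList

lead : ∀ {d} → Poly d → ℚ
lead = Vec.last

HasDegree : ∀ d → Poly d → Set
HasDegree d f = lead f ≢ 0ℚ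

NotMonomial : ∀ {d} → Poly d → Set
NotMonomial {d} f = ∃[ i ] ∃[ j ] (i ≢ j × lookup f i ≢ 0ℚ × lookup f j ≢ 0ℚ)

-- f (of degree d ≥ 1) has at least two distinct (complex) roots.  Over ℂ, f has
-- a single root iff f = c (x - α)^d, and then α = -a_{d-1}/(d a_d) ∈ ℚ; so this
-- is stated as: f is not c (x - α)^d for any c, α ∈ ℚ.
TwoDistinctRoots : ∀ {d} → Poly d → Set
TwoDistinctRoots {d} f =
  ¬ (∃[ c ] ∃[ α ] ((x : ℚ) → eval f x ≡ c ℚ.* ((x ℚ.- α) ^ℚ d)))

prodV : ∀ {n} → Vec ℕ n → ℕ
prodV = Vec.foldr _ _*_ 1

lhs : ∀ {r} → ℤ → Vec ℕ r → Vec ℕ r → ℤ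
lhs b A ns = b ℤ.* ℤ.+ (prodV (zipWith (λ a n → (n !!) * a ^ n) A ns))

-- Clearing denominators and completing the d-th power gives K D f(x) = y ^ d + E(x) with y = u x + v
-- and E of degree at most d - 2; E is not identically zero, as f is not c (x - α) ^ d. For a solution,
-- Z = K D b ∏ nᵢ!! Aᵢ ^ nᵢ has radical at most W 8 ^ n, where n = max nᵢ: every other prime factor
-- divides some nᵢ!!, so is at most n, and the product of the primes up to n is at most 8 ^ n.
-- ABC for y ^ d + E = Z, with gcd(y ^ d, E) divided out and ε = 1 / 2d, then bounds ∣ y ∣ ^ (d + 1)
-- by a constant times 8 ^ ((2d + 1) n). As n !! ≤ ∣ Z ∣ is at most a constant times ∣ y ∣ ^ d, the
-- superexponential growth of n !! bounds n, and with it y, x and the nᵢ.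
module Submission where

open import Defs
open import Data.Nat using (ℕ; _≤_; _<_)
open import Data.Integer using (ℤ; 0ℤ)
open import Data.Rational using (ℚ; _/_)
open import Data.Vec using (Vec)
open import Data.Vec.Relation.Unary.All using (All)
open import Data.List using (List)
open import Data.List.Membership.Propositional using (_∈_)
open import Data.Product using (_×_; _,_; ∃-syntax)
open import Relation.Binary.PropositionalEquality using (_≡_; _≢_)

open import Algebra.Bundles using (CommutativeRing)
open import Data.Nat using (zero; suc)
open import Data.Vec using ([]; _∷_; map; zipWith; init; last)
open import Data.Vec.Relation.Unary.All using ([]; _∷_)
open import Data.Vec.Relation.Binary.Pointwise.Inductive using (Pointwise; []; _∷_)
open import Relation.Binary.PropositionalEquality as ≡ using (refl; cong)

module _ {a b} {A : Set a} {B : Set b} (f : A → B) where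

  last-map : ∀ {n} (xs : Vec A (suc n)) → last (map f xs) ≡ f (last xs)
  last-map (x ∷ [])     = refl
  last-map (x ∷ y ∷ xs) = last-map (y ∷ xs)

  init-map : ∀ {n} (xs : Vec A (suc n)) → init (map f xs) ≡ map f (init xs)
  init-map (x ∷ [])     = refl
  init-map (x ∷ y ∷ xs) = cong (f x ∷_) (init-map (y ∷ xs))

module _ {a} {A : Set a} (f : A → A → A) where

  last-zipWith : ∀ {n} (xs ys : Vec A (suc n)) → last (zipWith f xs ys) ≡ f (last xs) (last ys)
  last-zipWith (x ∷ [])     (y ∷ [])      = refl
  last-zipWith (x ∷ x′ ∷ xs) (y ∷ y′ ∷ ys) = last-zipWith (x′ ∷ xs) (y′ ∷ ys)

  init-zipWith : ∀ {n} (xs ys : Vec A (suc n)) → init (zipWith f xs ys) ≡ zipWith f (init xs) (init ys)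
  init-zipWith (x ∷ [])     (y ∷ [])      = refl
  init-zipWith (x ∷ x′ ∷ xs) (y ∷ y′ ∷ ys) = cong (f x y ∷_) (init-zipWith (x′ ∷ xs) (y′ ∷ ys))

module _ {a p} {A : Set a} {P : A → Set p} where

  All-init-last : ∀ {n} (xs : Vec A (suc n)) → All P (init xs) → P (last xs) → All P xs
  All-init-last (x ∷ [])     []         Px = Px ∷ []
  All-init-last (x ∷ y ∷ xs) (Px ∷ Pxs) Py = Px ∷ All-init-last (y ∷ xs) Pxs Py

module Polynomial {c ℓ} (R : CommutativeRing c ℓ) where

  open CommutativeRing R renaming (refl to ≈-refl; sym to ≈-sym; trans to ≈-trans)
  open import Algebra.Properties.CommutativeSemiring.Exp commutativeSemiring public using (_^_; ^-distrib-*)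
  open import Algebra.Properties.Group +-group using (x∙y⁻¹≈ε⇒x≈y; x≈y⇒x∙y⁻¹≈ε)
  open import Algebra.Properties.Ring ring using (x[y-z]≈xy-xz)
  open import Algebra.Properties.AbelianGroup +-abelianGroup using (⁻¹-∙-comm; xyx⁻¹≈y)
  open import Algebra.Properties.CommutativeSemigroup +-commutativeSemigroup using (interchange)
  open import Algebra.Solver.Ring.NaturalCoefficients.Default commutativeSemiring using (solve; _:=_; _:+_; _:*_; con)
  open import Relation.Binary.Reasoning.Setoid setoid

  fromℕ : ℕ → Carrier
  fromℕ zero    = 0#
  fromℕ (suc n) = 1# + fromℕ n

  ⟦_⟧ : ∀ {n} → Vec Carrier n → Carrier → Carrier
  ⟦ []     ⟧ x = 0#
  ⟦ a ∷ as ⟧ x = a + x * ⟦ as ⟧ x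

  ⟦map-*⟧ : ∀ {n} k (p : Vec Carrier n) x → ⟦ map (k *_) p ⟧ x ≈ k * ⟦ p ⟧ x
  ⟦map-*⟧ k []      x = ≈-sym (zeroʳ k)
  ⟦map-*⟧ k (a ∷ p) x = begin
    k * a + x * ⟦ map (k *_) p ⟧ x ≈⟨ +-congˡ (*-congˡ (⟦map-*⟧ k p x)) ⟩
    k * a + x * (k * ⟦ p ⟧ x)      ≈⟨ solve 4 (λ k a x e → k :* a :+ x :* (k :* e) := k :* (a :+ x :* e)) ≈-refl k a x (⟦ p ⟧ x) ⟩
    k * (a + x * ⟦ p ⟧ x)          ∎

  ⟦zipWith-⟧ : ∀ {n} (p q : Vec Carrier n) x → ⟦ zipWith _-_ p q ⟧ x ≈ ⟦ p ⟧ x - ⟦ q ⟧ x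
  ⟦zipWith-⟧ []      []      x = ≈-sym (-‿inverseʳ 0#)
  ⟦zipWith-⟧ (a ∷ p) (b ∷ q) x = begin
    (a - b) + x * ⟦ zipWith _-_ p q ⟧ x        ≈⟨ +-congˡ (*-congˡ (⟦zipWith-⟧ p q x)) ⟩
    (a - b) + x * (⟦ p ⟧ x - ⟦ q ⟧ x)          ≈⟨ +-congˡ (x[y-z]≈xy-xz x (⟦ p ⟧ x) (⟦ q ⟧ x)) ⟩
    (a - b) + (x * ⟦ p ⟧ x - x * ⟦ q ⟧ x)      ≈⟨ interchange a (- b) (x * ⟦ p ⟧ x) (- (x * ⟦ q ⟧ x)) ⟩
    (a + x * ⟦ p ⟧ x) + (- b - x * ⟦ q ⟧ x)    ≈⟨ +-congˡ (⁻¹-∙-comm b (x * ⟦ q ⟧ x)) ⟩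
    (a + x * ⟦ p ⟧ x) - (b + x * ⟦ q ⟧ x)      ∎

  ⟦⟧≈⟦init⟧+x^n*last : ∀ {n} (p : Vec Carrier (suc n)) x → ⟦ p ⟧ x ≈ ⟦ init p ⟧ x + x ^ n * last p
  ⟦⟧≈⟦init⟧+x^n*last (a ∷ [])    x = solve 2 (λ a x → a :+ x :* con 0 := con 0 :+ con 1 :* a) ≈-refl a x
  ⟦⟧≈⟦init⟧+x^n*last {suc n} (a ∷ b ∷ p) x = begin
    a + x * ⟦ b ∷ p ⟧ x                                       ≈⟨ +-congˡ (*-congˡ (⟦⟧≈⟦init⟧+x^n*last (b ∷ p) x)) ⟩
    a + x * (⟦ init (b ∷ p) ⟧ x + x ^ n * last (b ∷ p))        ≈⟨ solve 5 (λ a x e xⁿ l → a :+ x :* (e :+ xⁿ :* l) := (a :+ x :* e) :+ x :* xⁿ :* l)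
                                                                       ≈-refl a x (⟦ init (b ∷ p) ⟧ x) (x ^ n) (last (b ∷ p)) ⟩
    (a + x * ⟦ init (b ∷ p) ⟧ x) + x * x ^ n * last (b ∷ p)   ∎

  ⟦⟧≈⟦init⟧ : ∀ {n} (p : Vec Carrier (suc n)) x → last p ≈ 0# → ⟦ p ⟧ x ≈ ⟦ init p ⟧ x
  ⟦⟧≈⟦init⟧ {n} p x last≈0 = begin
    ⟦ p ⟧ x                        ≈⟨ ⟦⟧≈⟦init⟧+x^n*last p x ⟩
    ⟦ init p ⟧ x + x ^ n * last p  ≈⟨ +-congˡ (≈-trans (*-congˡ last≈0) (zeroʳ _)) ⟩
    ⟦ init p ⟧ x + 0#              ≈⟨ +-identityʳ _ ⟩
    ⟦ init p ⟧ x                   ∎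

  -- Multiplication by v + u X; the coefficient a₋ preceding p is carried into the first one.
  mulLinear : ∀ {n} → Carrier → Carrier → Carrier → Vec Carrier n → Vec Carrier (suc n)
  mulLinear u v a₋ []      = u * a₋ ∷ []
  mulLinear u v a₋ (a ∷ p) = v * a + u * a₋ ∷ mulLinear u v a p

  ⟦mulLinear⟧ : ∀ {n} u v a₋ (p : Vec Carrier n) x → ⟦ mulLinear u v a₋ p ⟧ x ≈ (v + u * x) * ⟦ p ⟧ x + u * a₋
  ⟦mulLinear⟧ u v a₋ []      x = solve 4 (λ u v a₋ x → u :* a₋ :+ x :* con 0 := (v :+ u :* x) :* con 0 :+ u :* a₋) ≈-refl u v a₋ x
  ⟦mulLinear⟧ u v a₋ (a ∷ p) x = begin
    (v * a + u * a₋) + x * ⟦ mulLinear u v a p ⟧ x               ≈⟨ +-congˡ (*-congˡ (⟦mulLinear⟧ u v a p x)) ⟩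
    (v * a + u * a₋) + x * ((v + u * x) * ⟦ p ⟧ x + u * a)        ≈⟨ solve 6 (λ u v a₋ a x e → (v :* a :+ u :* a₋) :+ x :* ((v :+ u :* x) :* e :+ u :* a)
                                                                           := (v :+ u :* x) :* (a :+ x :* e) :+ u :* a₋) ≈-refl u v a₋ a x (⟦ p ⟧ x) ⟩
    (v + u * x) * (a + x * ⟦ p ⟧ x) + u * a₋                      ∎

  last-mulLinear : ∀ {n} u v a₋ (p : Vec Carrier (suc n)) → last (mulLinear u v a₋ p) ≡ u * last p
  last-mulLinear u v a₋ (a ∷ [])    = ≡.refl
  last-mulLinear u v a₋ (a ∷ b ∷ p) = last-mulLinear u v a (b ∷ p)

  last-init-mulLinear : ∀ {n} u v a₋ (p : Vec Carrier (suc (suc n))) →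
                        last (init (mulLinear u v a₋ p)) ≡ v * last p + u * last (init p)
  last-init-mulLinear u v a₋ (a ∷ b ∷ [])    = ≡.refl
  last-init-mulLinear u v a₋ (a ∷ b ∷ c ∷ p) = last-init-mulLinear u v a (b ∷ c ∷ p)

  linearPower : Carrier → Carrier → (k : ℕ) → Vec Carrier (suc k)
  linearPower u v zero    = 1# ∷ []
  linearPower u v (suc k) = mulLinear u v 0# (linearPower u v k)

  ⟦linearPower⟧ : ∀ u v k x → ⟦ linearPower u v k ⟧ x ≈ (v + u * x) ^ k
  ⟦linearPower⟧ u v zero    x = ≈-trans (+-congˡ (zeroʳ x)) (+-identityʳ 1#)
  ⟦linearPower⟧ u v (suc k) x = begin
    ⟦ mulLinear u v 0# (linearPower u v k) ⟧ x         ≈⟨ ⟦mulLinear⟧ u v 0# (linearPower u v k) x ⟩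
    (v + u * x) * ⟦ linearPower u v k ⟧ x + u * 0#     ≈⟨ +-cong (*-congˡ (⟦linearPower⟧ u v k x)) (zeroʳ u) ⟩
    (v + u * x) * (v + u * x) ^ k + 0#                 ≈⟨ +-identityʳ _ ⟩
    (v + u * x) ^ suc k                                ∎

  last-linearPower : ∀ u v k → last (linearPower u v k) ≈ u ^ k
  last-linearPower u v zero    = ≈-refl
  last-linearPower u v (suc k) = ≈-trans (reflexive (last-mulLinear u v 0# (linearPower u v k))) (*-congˡ (last-linearPower u v k))

  last-init-linearPower : ∀ u v k → last (init (linearPower u v (suc k))) ≈ fromℕ (suc k) * (u ^ k * v)
  last-init-linearPower u v zero    = solve 2 (λ u v → v :* con 1 :+ u :* con 0 := (con 1 :+ con 0) :* (con 1 :* v)) ≈-refl u v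
  last-init-linearPower u v (suc k) = begin
    last (init (mulLinear u v 0# (linearPower u v (suc k))))                  ≡⟨ last-init-mulLinear u v 0# (linearPower u v (suc k)) ⟩
    v * last (linearPower u v (suc k)) + u * last (init (linearPower u v (suc k))) ≈⟨ +-cong (*-congˡ (last-linearPower u v (suc k))) (*-congˡ (last-init-linearPower u v k)) ⟩
    v * (u * u ^ k) + u * (fromℕ (suc k) * (u ^ k * v))                        ≈⟨ solve 4 (λ u v uᵏ n → v :* (u :* uᵏ) :+ u :* (n :* (uᵏ :* v)) := (con 1 :+ n) :* (u :* uᵏ :* v))
                                                                                   ≈-refl u v (u ^ k) (fromℕ (suc k)) ⟩
    fromℕ (suc (suc k)) * (u ^ suc k * v)                                      ∎

  zipWith-≈0⇒Pointwise : ∀ {n} (p q : Vec Carrier n) → All (_≈ 0#) (zipWith _-_ p q) → Pointwise _≈_ p q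
  zipWith-≈0⇒Pointwise []      []      []                = []
  zipWith-≈0⇒Pointwise (a ∷ p) (b ∷ q) (a-b≈0 ∷ p-q≈0) = x∙y⁻¹≈ε⇒x≈y a b a-b≈0 ∷ zipWith-≈0⇒Pointwise p q p-q≈0

  -- For c of degree d with top coefficients a, b, the choice u = d a, v = b, K = d ^ d a ^ (d - 1)
  -- makes K c(X) and (v + u X) ^ d agree in their two top coefficients.
  module Completion {k} (c : Vec Carrier (suc (suc k))) where

    δ u v K : Carrier
    δ = fromℕ (suc k)
    u = δ * last c
    v = last (init c)
    K = δ ^ suc k * last c ^ k

    difference : Vec Carrier (suc (suc k))
    difference = zipWith _-_ (map (K *_) c) (linearPower u v (suc k))

    remainder : Vec Carrier k
    remainder = init (init difference)

    last-difference≈0 : last difference ≈ 0#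
    last-difference≈0 = begin
      last difference                                   ≡⟨ last-zipWith _-_ (map (K *_) c) (linearPower u v (suc k)) ⟩
      last (map (K *_) c) - last (linearPower u v (suc k)) ≈⟨ +-cong (reflexive (last-map (K *_) c)) (-‿cong (last-linearPower u v (suc k))) ⟩
      K * last c - u ^ suc k                             ≈⟨ x≈y⇒x∙y⁻¹≈ε K*a≈u^d ⟩
      0#                                                 ∎
      where
      a = last c
      K*a≈u^d : K * a ≈ u ^ suc k
      K*a≈u^d = begin
        δ ^ suc k * a ^ k * a     ≈⟨ solve 3 (λ δᵈ aᵏ a → δᵈ :* aᵏ :* a := δᵈ :* (a :* aᵏ)) ≈-refl (δ ^ suc k) (a ^ k) a ⟩
        δ ^ suc k * a ^ suc k     ≈⟨ ^-distrib-* δ a (suc k) ⟨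
        u ^ suc k                 ∎

    last-init-difference≈0 : last (init difference) ≈ 0#
    last-init-difference≈0 = begin
      last (init difference)
        ≡⟨ ≡.cong last (init-zipWith _-_ (map (K *_) c) (linearPower u v (suc k))) ⟩
      last (zipWith _-_ (init (map (K *_) c)) (init (linearPower u v (suc k))))
        ≡⟨ last-zipWith _-_ (init (map (K *_) c)) _ ⟩
      last (init (map (K *_) c)) - last (init (linearPower u v (suc k)))
        ≈⟨ +-cong (reflexive (≡.trans (≡.cong last (init-map (K *_) c)) (last-map (K *_) (init c))))
                  (-‿cong (last-init-linearPower u v k)) ⟩
      K * v - δ * (u ^ k * v)
        ≈⟨ x≈y⇒x∙y⁻¹≈ε K*v≈δ*uᵏ*v ⟩
      0# ∎
      where
      a = last c
      K*v≈δ*uᵏ*v : K * v ≈ δ * (u ^ k * v)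
      K*v≈δ*uᵏ*v = begin
        δ * δ ^ k * a ^ k * v       ≈⟨ solve 4 (λ δ δᵏ aᵏ v → δ :* δᵏ :* aᵏ :* v := δ :* (δᵏ :* aᵏ :* v)) ≈-refl δ (δ ^ k) (a ^ k) v ⟩
        δ * (δ ^ k * a ^ k * v)     ≈⟨ *-congˡ (*-congʳ (^-distrib-* δ a k)) ⟨
        δ * (u ^ k * v)             ∎

    ⟦difference⟧≈⟦remainder⟧ : ∀ x → ⟦ difference ⟧ x ≈ ⟦ remainder ⟧ x
    ⟦difference⟧≈⟦remainder⟧ x =
      ≈-trans (⟦⟧≈⟦init⟧ difference x last-difference≈0) (⟦⟧≈⟦init⟧ (init difference) x last-init-difference≈0)

    K*⟦c⟧≈power+⟦remainder⟧ : ∀ x → K * ⟦ c ⟧ x ≈ (v + u * x) ^ suc k + ⟦ remainder ⟧ x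
    K*⟦c⟧≈power+⟦remainder⟧ x = begin
      K * ⟦ c ⟧ x                                 ≈⟨ xyx⁻¹≈y P (K * ⟦ c ⟧ x) ⟨
      P + K * ⟦ c ⟧ x - P                         ≈⟨ +-assoc P _ _ ⟩
      P + (K * ⟦ c ⟧ x - P)                       ≈⟨ +-congˡ ⟦difference⟧≈ ⟨
      P + ⟦ difference ⟧ x                        ≈⟨ +-congˡ (⟦difference⟧≈⟦remainder⟧ x) ⟩
      P + ⟦ remainder ⟧ x                         ∎
      where
      P = (v + u * x) ^ suc k
      ⟦difference⟧≈ : ⟦ difference ⟧ x ≈ K * ⟦ c ⟧ x - P
      ⟦difference⟧≈ = ≈-trans (⟦zipWith-⟧ (map (K *_) c) (linearPower u v (suc k)) x)
                              (+-cong (⟦map-*⟧ K c x) (-‿cong (⟦linearPower⟧ u v (suc k) x)))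

    remainder≈0⇒K*c≈linearPower : All (_≈ 0#) remainder → Pointwise _≈_ (map (K *_) c) (linearPower u v (suc k))
    remainder≈0⇒K*c≈linearPower remainder≈0 = zipWith-≈0⇒Pointwise _ _
      (All-init-last difference (All-init-last (init difference) remainder≈0 last-init-difference≈0) last-difference≈0)

open import Level using (0ℓ)
open import Function using (_∘_)
open import Data.Nat as ℕ using (_+_; _*_; _^_; _∸_; _⊔_; z≤n; s≤s; NonZero; _!)
open import Data.Nat.Properties
open import Algebra.Properties.CommutativeSemigroup *-commutativeSemigroup using (x∙yz≈y∙xz)
open import Data.Nat.Divisibility using (_∣_; divides; _∣?_; ∣⇒≤; ∣1⇒≡1; 1∣_; ∣-refl; ∣-reflexive; *-monoʳ-∣; ∣m⇒∣m*n; ∣n⇒∣m*n; ∣-trans; m≤n⇒m!∣n!)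
open import Data.Nat.DivMod using (m*[n/m]≡n)
open import Data.Nat.Primality using (Prime; prime?; prime[2]; ¬prime[1]; euclidsLemma; prime⇒irreducible; prime⇒nonZero; productOfPrimes≢0)
open import Data.Nat.Combinatorics using (_C_; nCk+nC[k+1]≡[n+1]C[k+1]; k![n∸k]!∣n!; nCk≡n!/k![n-k]!)
open import Data.Nat.Coprimality using (Coprime; gcd≡1⇒coprime)
open import Data.Nat.GCD using (gcd; gcd[m,n]∣m; gcd[m,n]∣n; gcd[m,n]≢0; c*gcd[m,n]≡gcd[cm,cn])
open import Data.Nat.Induction using (<-rec)
open import Data.Nat.ListAction using (product)
open import Data.Nat.ListAction.Properties using (∈⇒∣product)
import Data.Nat.Tactic.RingSolver as ℕSolver
open import Data.Integer as ℤ using (+_; -[1+_]; ∣_∣; 1ℤ)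
import Data.Integer.Properties as ℤP
import Data.Integer.Divisibility.Signed as ℤ∣
import Data.Integer.Tactic.RingSolver as ℤSolver
open import Data.Rational as ℚ using (mkℚ; ↥_; ↧ₙ_; 0ℚ; 1ℚ; 1/_)
import Data.Rational.Properties as ℚP
open import Data.Rational.Unnormalised as ℚᵘ using (mkℚᵘ; *≡*)
import Data.Rational.Unnormalised.Properties as ℚᵘP
open import Algebra.Properties.Group (CommutativeRing.+-group ℤP.+-*-commutativeRing) using (inverseˡ-unique)
open import Algebra.Properties.Group (CommutativeRing.+-group ℚP.+-*-commutativeRing) using (⁻¹-involutive)
import Algebra.Properties.CommutativeSemigroup
open import Data.Vec.Properties using (map-∘; map-cong)
open import Data.Vec.Relation.Unary.Any using (Any; here; there; any?)
open import Data.Vec.Relation.Binary.Pointwise.Inductive using (Pointwise-≡⇒≡)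
open import Data.List using ([]; _∷_; filter; upTo; _++_; cartesianProduct; cartesianProductWith)
import Data.List as List
import Data.List.Relation.Unary.All as ListAll
open import Data.List.Relation.Unary.All.Properties using (all-filter)
open import Data.List.Relation.Unary.Any using (here; there)
open import Data.List.Relation.Unary.Unique.Propositional using (Unique; _∷_)
open import Data.List.Relation.Unary.Unique.Propositional.Properties using (upTo⁺)
open import Data.List.Membership.Propositional.Properties
  using (∈-filter⁺; ∈-upTo⁺; ∈-upTo⁻; ∈-map⁺; ∈-++⁺ˡ; ∈-++⁺ʳ; ∈-cartesianProductWith⁺; ∈-cartesianProduct⁺)
open import Data.Product using (proj₁; proj₂)
open import Data.Sum using (_⊎_; inj₁; inj₂)
open import Relation.Nullary using (¬_; yes; no; contradiction)
open import Relation.Nullary.Decidable using (_×-dec_; decidable-stable; ¬?)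
open import Relation.Unary using (Pred; Decidable)
open import Relation.Binary.PropositionalEquality using (sym; trans; cong₂; subst; module ≡-Reasoning)

module ℚ* = Algebra.Properties.CommutativeSemigroup (CommutativeRing.*-commutativeSemigroup ℚP.+-*-commutativeRing)

prime∣prime⇒≡ : ∀ {p q} → Prime p → Prime q → p ∣ q → p ≡ q
prime∣prime⇒≡ pp pq p∣q with prime⇒irreducible pq p∣q
... | inj₁ refl = contradiction pp ¬prime[1]
... | inj₂ p≡q  = p≡q

prime∣^⇒∣ : ∀ {p a} k → Prime p → p ∣ a ^ k → p ∣ a
prime∣^⇒∣ zero    pp p∣1 = contradiction (subst Prime (∣1⇒≡1 p∣1) pp) ¬prime[1]
prime∣^⇒∣ {a = a} (suc k) pp p∣a*aᵏ with euclidsLemma a (a ^ k) pp p∣a*aᵏ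
... | inj₁ p∣a  = p∣a
... | inj₂ p∣aᵏ = prime∣^⇒∣ k pp p∣aᵏ

module _ {P : Pred ℕ 0ℓ} (P? : Decidable P) where

  -- If m = k x with x prime, the remaining primes of the list, all different from x, divide k.
  product-filter-primes-∣ : ∀ {xs m} → Unique xs → (∀ {p} → p ∈ xs → P p → Prime p × p ∣ m) →
                            product (filter P? xs) ∣ m
  product-filter-primes-∣ {[]}     _              _ = 1∣ _
  product-filter-primes-∣ {x ∷ xs} (x∉xs ∷ uniq) h with P? x
  ... | no  _  = product-filter-primes-∣ uniq (h ∘ there)
  ... | yes Px with h (here refl) Px
  ...   | px , divides k refl =
    subst (x * product (filter P? xs) ∣_) (*-comm x k) (*-monoʳ-∣ x (product-filter-primes-∣ uniq h′))
    where
    h′ : ∀ {p} → p ∈ xs → P p → Prime p × p ∣ k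
    h′ p∈xs Pp with h (there p∈xs) Pp
    ... | pp , p∣kx with euclidsLemma k x pp p∣kx
    ...   | inj₁ p∣k = pp , p∣k
    ...   | inj₂ p∣x = contradiction (sym (prime∣prime⇒≡ pp px p∣x)) (ListAll.lookup x∉xs p∈xs)

rad-∣ : ∀ {a m} → (∀ {p} → Prime p → p ∣ a → p ∣ m) → rad a ∣ m
rad-∣ {a} h = product-filter-primes-∣ (λ p → prime? p ×-dec (p ∣? a)) (upTo⁺ (suc a)) (λ _ (pp , p∣a) → pp , h pp p∣a)

∣rad : ∀ {p a} .{{_ : NonZero a}} → Prime p → p ∣ a → p ∣ rad a
∣rad {a = a} pp p∣a = ∈⇒∣product (∈-filter⁺ (λ p → prime? p ×-dec (p ∣? a)) (∈-upTo⁺ (s≤s (∣⇒≤ p∣a))) (pp , p∣a))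

primorial : ℕ → ℕ
primorial n = product (filter prime? (upTo (suc n)))

∣primorial : ∀ {p n} → Prime p → p ≤ n → p ∣ primorial n
∣primorial pp p≤n = ∈⇒∣product (∈-filter⁺ prime? (∈-upTo⁺ (s≤s p≤n)) pp)

primorial-≤ : ∀ {n m} .{{_ : NonZero m}} → (∀ {p} → Prime p → p ≤ n → p ∣ m) → primorial n ≤ m
primorial-≤ {n} h = ∣⇒≤ (product-filter-primes-∣ prime? (upTo⁺ (suc n)) (λ p∈ pp → pp , h pp (≤-pred (∈-upTo⁻ p∈))))

prime∣n!⇒≤ : ∀ {p} n → Prime p → p ∣ n ! → p ≤ n
prime∣n!⇒≤ zero    pp p∣1 = contradiction (subst Prime (∣1⇒≡1 p∣1) pp) ¬prime[1]
prime∣n!⇒≤ (suc n) pp p∣n! with euclidsLemma (suc n) (n !) pp p∣n!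
... | inj₁ p∣1+n = ∣⇒≤ p∣1+n
... | inj₂ p∣n!  = m≤n⇒m≤1+n (prime∣n!⇒≤ n pp p∣n!)

C*k!*[n∸k]!≡n! : ∀ {n k} → k ≤ n → (n C k) * (k ! * (n ∸ k) !) ≡ n !
C*k!*[n∸k]!≡n! {n} {k} k≤n = trans (*-comm (n C k) _)
  (trans (cong (k ! * (n ∸ k) ! *_) (nCk≡n!/k![n-k]! k≤n)) (m*[n/m]≡n (k![n∸k]!∣n! k≤n)))
  where instance _ = k !* (n ∸ k) !≢0

nCk≢0 : ∀ {n k} → k ≤ n → NonZero (n C k)
nCk≢0 {n} {k} k≤n = ℕ.≢-nonZero λ C≡0 →
  ℕ.≢-nonZero⁻¹ (n !) {{n !≢0}} (trans (sym (C*k!*[n∸k]!≡n! k≤n)) (cong (_* (k ! * (n ∸ k) !)) C≡0))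

nCk≤2^n : ∀ n k → n C k ≤ 2 ^ n
nCk≤2^n zero    zero    = ≤-refl
nCk≤2^n zero    (suc k) = z≤n
nCk≤2^n (suc n) zero    = m^n>0 2 (suc n)
nCk≤2^n (suc n) (suc k) = begin
  suc n C suc k         ≡⟨ nCk+nC[k+1]≡[n+1]C[k+1] n k ⟨
  n C k + n C suc k     ≤⟨ +-mono-≤ (nCk≤2^n n k) (nCk≤2^n n (suc k)) ⟩
  2 ^ n + 2 ^ n         ≡⟨ cong (λ x → 2 ^ n + x) (+-identityʳ (2 ^ n)) ⟨
  2 ^ suc n             ∎
  where open ≤-Reasoning

n∣n! : ∀ n .{{_ : NonZero n}} → n ∣ n !
n∣n! (suc n) = ∣m⇒∣m*n (n !) ∣-refl

prime∣middleBinomial : ∀ {p} M → Prime p → suc M < p → p ≤ M + suc M → p ∣ (M + suc M) C M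
prime∣middleBinomial {p} M pp M+1<p p≤n
  with euclidsLemma ((M + suc M) C M) (M ! * (M + suc M ∸ M) !) pp
         (subst (p ∣_) (sym (C*k!*[n∸k]!≡n! (m≤m+n M (suc M))))
           (∣-trans (n∣n! p {{prime⇒nonZero pp}}) (m≤n⇒m!∣n! p≤n)))
... | inj₁ p∣C = p∣C
... | inj₂ p∣M![M+1]! with euclidsLemma (M !) ((M + suc M ∸ M) !) pp p∣M![M+1]!
...   | inj₁ p∣M!     = contradiction (prime∣n!⇒≤ M pp p∣M!) (<⇒≱ (<-trans (n<1+n M) M+1<p))
...   | inj₂ p∣[M+1]! =
  contradiction (subst (p ≤_) (m+n∸m≡n M (suc M)) (prime∣n!⇒≤ _ pp p∣[M+1]!)) (<⇒≱ M+1<p)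

primorial≢0 : ∀ n → NonZero (primorial n)
primorial≢0 n = productOfPrimes≢0 (all-filter prime? (upTo (suc n)))

even⊎odd : ∀ n → ∃[ m ] (n ≡ m + m ⊎ n ≡ m + suc m)
even⊎odd zero    = 0 , inj₁ refl
even⊎odd (suc n) with even⊎odd n
... | m , inj₁ refl = m , inj₂ (sym (+-suc m m))
... | m , inj₂ refl = suc m , inj₁ refl

primorial≤8^n : ∀ n → primorial n ≤ 8 ^ n
primorial≤8^n = <-rec (λ n → primorial n ≤ 8 ^ n) step
  where
  open ≤-Reasoning

  -- Every prime p ≤ 2M + 2 except possibly p = 2 is at most 2M + 1.
  even : ∀ M → primorial (M + suc M) ≤ 8 ^ (M + suc M) → primorial (suc M + suc M) ≤ 8 ^ (suc M + suc M)
  even M ih = begin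
    primorial (suc n)   ≤⟨ primorial-≤ {{m*n≢0 2 _ {{_}} {{primorial≢0 n}}}} ∣2*primorial ⟩
    2 * primorial n     ≤⟨ *-monoʳ-≤ 2 ih ⟩
    2 * 8 ^ n           ≤⟨ *-monoˡ-≤ (8 ^ n) {2} {8} (s≤s (s≤s z≤n)) ⟩
    8 ^ suc n           ∎
    where
    n = M + suc M
    ∣2*primorial : ∀ {p} → Prime p → p ≤ suc n → p ∣ 2 * primorial n
    ∣2*primorial {p} pp p≤1+n with m≤n⇒m<n∨m≡n p≤1+n
    ... | inj₁ p<1+n = ∣n⇒∣m*n 2 (∣primorial pp (≤-pred p<1+n))
    ... | inj₂ refl  = ∣m⇒∣m*n (primorial n)
      (∣-reflexive (sym (prime∣prime⇒≡ prime[2] pp (divides (suc M) (trans (cong (λ x → suc M + x) (sym (+-identityʳ (suc M)))) (*-comm 2 (suc M)))))))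

  -- The primes in (M + 1, 2M + 1] all divide the binomial coefficient (2M + 1 choose M) ≤ 2 ^ (2M + 1).
  odd : ∀ m → primorial (suc (suc m)) ≤ 8 ^ suc (suc m) → primorial (suc m + suc (suc m)) ≤ 8 ^ (suc m + suc (suc m))
  odd m ih = begin
    primorial n                  ≤⟨ primorial-≤ {{m*n≢0 _ _ {{primorial≢0 (suc M)}} {{nCk≢0 (m≤m+n M (suc M))}}}} ∣primorial*C ⟩
    primorial (suc M) * (n C M)  ≤⟨ *-mono-≤ ih (nCk≤2^n n M) ⟩
    8 ^ suc M * 2 ^ n            ≤⟨ *-monoʳ-≤ (8 ^ suc M) 2^n≤8^M ⟩
    8 ^ suc M * 8 ^ M            ≡⟨ ^-distribˡ-+-* 8 (suc M) M ⟨
    8 ^ (suc M + M)              ≡⟨ cong (8 ^_) (sym (+-suc M M)) ⟩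
    8 ^ n                        ∎
    where
    M = suc m
    n = M + suc M
    ∣primorial*C : ∀ {p} → Prime p → p ≤ n → p ∣ primorial (suc M) * (n C M)
    ∣primorial*C {p} pp p≤n with p ≤? suc M
    ... | yes p≤1+M = ∣m⇒∣m*n _ (∣primorial pp p≤1+M)
    ... | no  p≰1+M = ∣n⇒∣m*n (primorial (suc M)) (prime∣middleBinomial M pp (≰⇒> p≰1+M) p≤n)
    n≤3M : n ≤ 3 * M
    n≤3M = +-monoʳ-≤ M (s≤s (≤-trans (m≤n+m (suc m) m) (+-monoʳ-≤ m (s≤s (m≤m+n m 0)))))
    2^n≤8^M : 2 ^ n ≤ 8 ^ M
    2^n≤8^M = ≤-trans (^-monoʳ-≤ 2 n≤3M) (≤-reflexive (sym (^-*-assoc 2 3 M)))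

  step : ∀ n → (∀ {m} → m < n → primorial m ≤ 8 ^ m) → primorial n ≤ 8 ^ n
  step n rec with even⊎odd n
  ... | zero  , inj₁ refl = ≤-refl
  ... | zero  , inj₂ refl = s≤s z≤n
  ... | suc m , inj₁ refl = even m (rec ≤-refl)
  ... | suc m , inj₂ refl = odd m (rec (s≤s (m≤n+m (suc (suc m)) m)))

[m*n]^k≡m^k*n^k : ∀ m n k → (m * n) ^ k ≡ m ^ k * n ^ k
[m*n]^k≡m^k*n^k m n zero    = refl
[m*n]^k≡m^k*n^k m n (suc k) = begin-equality
  m * n * (m * n) ^ k         ≡⟨ cong (m * n *_) ([m*n]^k≡m^k*n^k m n k) ⟩
  m * n * (m ^ k * n ^ k)     ≡⟨ *-assoc m n _ ⟩
  m * (n * (m ^ k * n ^ k))   ≡⟨ cong (m *_) (x∙yz≈y∙xz n (m ^ k) (n ^ k)) ⟩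
  m * (m ^ k * (n * n ^ k))   ≡⟨ *-assoc m (m ^ k) _ ⟨
  m * m ^ k * (n * n ^ k)     ∎
  where open ≤-Reasoning

n<2^n : ∀ n → n < 2 ^ n
n<2^n zero    = s≤s z≤n
n<2^n (suc n) = +-mono-≤-< (m^n>0 2 n) (≤-trans (n<2^n n) (m≤m+n (2 ^ n) 0))

n!!≢0 : ∀ n → NonZero (n !!)
n!!≢0 zero          = _
n!!≢0 (suc zero)    = _
n!!≢0 (suc (suc n)) = m*n≢0 (suc (suc n)) (n !!) {{_}} {{n!!≢0 n}}

n≤n!! : ∀ n → n ≤ n !!
n≤n!! zero          = z≤n
n≤n!! (suc zero)    = ≤-refl
n≤n!! (suc (suc n)) = m≤m*n (suc (suc n)) (n !!) {{n!!≢0 n}}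

prime∣n!!⇒≤ : ∀ {p} n → Prime p → p ∣ n !! → p ≤ n
prime∣n!!⇒≤ zero          pp p∣1 = contradiction (subst Prime (∣1⇒≡1 p∣1) pp) ¬prime[1]
prime∣n!!⇒≤ (suc zero)    pp p∣1 = contradiction (subst Prime (∣1⇒≡1 p∣1) pp) ¬prime[1]
prime∣n!!⇒≤ (suc (suc n)) pp p∣n!! with euclidsLemma (suc (suc n)) (n !!) pp p∣n!!
... | inj₁ p∣2+n = ∣⇒≤ p∣2+n
... | inj₂ p∣n!! = ≤-trans (prime∣n!!⇒≤ n pp p∣n!!) (m≤n+m n 2)

-- Once n ≥ h², every further factor of n !! is at least h * h.
^≤^*!! : ∀ h n .{{_ : NonZero h}} → h ^ n ≤ h ^ (h * h) * n !!
^≤^*!! h n with n ≤? h * h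
... | yes n≤h² = ≤-trans (^-monoʳ-≤ h n≤h²) (m≤m*n _ (n !!) {{n!!≢0 n}})
^≤^*!! h zero          | no n≰h² = contradiction z≤n n≰h²
^≤^*!! h (suc zero)    | no n≰h² = contradiction (ℕ.>-nonZero⁻¹ (h * h) {{m*n≢0 h h}}) n≰h²
^≤^*!! h (suc (suc n)) | no n≰h² = begin
  h * (h * h ^ n)              ≡⟨ *-assoc h h (h ^ n) ⟨
  h * h * h ^ n                ≤⟨ *-monoˡ-≤ (h ^ n) (<⇒≤ (≰⇒> n≰h²)) ⟩
  suc (suc n) * h ^ n          ≤⟨ *-monoʳ-≤ (suc (suc n)) (^≤^*!! h n) ⟩
  suc (suc n) * (T * (n !!))   ≡⟨ x∙yz≈y∙xz (suc (suc n)) T (n !!) ⟩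
  T * (suc (suc n) * (n !!))   ∎
  where
  open ≤-Reasoning
  T = h ^ (h * h)

!!≤c*g^n⇒n≤ : ∀ c g n .{{_ : NonZero g}} → n !! ≤ c * g ^ n → n ≤ (2 * g) ^ (2 * g * (2 * g)) * c
!!≤c*g^n⇒n≤ c g n n!!≤ = <⇒≤ (≤-trans (n<2^n n) (*-cancelʳ-≤ (2 ^ n) (T * c) (g ^ n) {{m^n≢0 g n}} (begin
  2 ^ n * g ^ n       ≡⟨ [m*n]^k≡m^k*n^k 2 g n ⟨
  (2 * g) ^ n         ≤⟨ ^≤^*!! (2 * g) n {{m*n≢0 2 g}} ⟩
  T * (n !!)          ≤⟨ *-monoʳ-≤ T n!!≤ ⟩
  T * (c * g ^ n)     ≡⟨ *-assoc T c _ ⟨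
  T * c * g ^ n       ∎)))
  where
  open ≤-Reasoning
  T = (2 * g) ^ (2 * g * (2 * g))

rad≢0 : ∀ n → NonZero (rad n)
rad≢0 n = productOfPrimes≢0 (ListAll.map proj₁ (all-filter (λ p → prime? p ×-dec (p ∣? n)) (upTo (suc n))))

module ℤ[X] = Polynomial ℤP.+-*-commutativeRing
module ℚ[X] = Polynomial ℚP.+-*-commutativeRing

ι : ℤ → ℚ
ι z = z / 1

private
  ι-fromℚᵘ : ∀ q z → ℚ.toℚᵘ q ℚᵘ.≃ mkℚᵘ z 0 → q ≡ ι z
  ι-fromℚᵘ q z q≃z = trans (sym (ℚP.fromℚᵘ-toℚᵘ q)) (ℚP.fromℚᵘ-cong q≃z)

  toℚᵘ-ι : ∀ z → ℚ.toℚᵘ (ι z) ℚᵘ.≃ mkℚᵘ z 0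
  toℚᵘ-ι z = ℚP.toℚᵘ-fromℚᵘ (mkℚᵘ z 0)

ι-+ : ∀ a b → ι (a ℤ.+ b) ≡ ι a ℚ.+ ι b
ι-+ a b = sym (ι-fromℚᵘ _ (a ℤ.+ b) (ℚᵘP.≃-trans (ℚP.toℚᵘ-homo-+ (ι a) (ι b))
  (ℚᵘP.≃-trans (ℚᵘP.+-cong (toℚᵘ-ι a) (toℚᵘ-ι b)) (*≡* (lemma a b)))))
  where
  lemma : ∀ a b → (a ℤ.* + 1 ℤ.+ b ℤ.* + 1) ℤ.* + 1 ≡ (a ℤ.+ b) ℤ.* + 1
  lemma = ℤSolver.solve-∀

ι-* : ∀ a b → ι (a ℤ.* b) ≡ ι a ℚ.* ι b
ι-* a b = sym (ι-fromℚᵘ _ (a ℤ.* b) (ℚᵘP.≃-trans (ℚP.toℚᵘ-homo-* (ι a) (ι b))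
  (ℚᵘP.≃-trans (ℚᵘP.*-cong (toℚᵘ-ι a) (toℚᵘ-ι b)) (*≡* refl))))

ι-injective : ∀ {a b} → ι a ≡ ι b → a ≡ b
ι-injective {a} {b} ιa≡ιb with ℚᵘP.≃-trans (ℚᵘP.≃-sym (toℚᵘ-ι a)) (ℚᵘP.≃-trans (ℚP.toℚᵘ-cong ιa≡ιb) (toℚᵘ-ι b))
... | *≡* eq = trans (sym (ℤP.*-identityʳ a)) (trans eq (ℤP.*-identityʳ b))

map-ι-* : ∀ {n} k (c : Vec ℤ n) → map ι (map (k ℤ.*_) c) ≡ map (ι k ℚ.*_) (map ι c)
map-ι-* k c = trans (sym (map-∘ ι (k ℤ.*_) c)) (trans (map-cong (ι-* k) c) (map-∘ (ι k ℚ.*_) ι c))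

ι↧*q≡ι↥ : ∀ q → ι (+ ↧ₙ q) ℚ.* q ≡ ι (↥ q)
ι↧*q≡ι↥ q@(mkℚ n d _) = ι-fromℚᵘ _ n (ℚᵘP.≃-trans (ℚP.toℚᵘ-homo-* (ι (+ ↧ₙ q)) q)
  (ℚᵘP.≃-trans (ℚᵘP.*-cong (toℚᵘ-ι (+ suc d)) (ℚᵘP.≃-refl {mkℚᵘ n d})) (*≡* (lemma n (+ suc d)))))
  where
  lemma : ∀ n d → (d ℤ.* n) ℤ.* + 1 ≡ n ℤ.* (+ 1 ℤ.* d)
  lemma = ℤSolver.solve-∀

clearDenominators : ∀ {n} (f : Vec ℚ n) → ∃[ D ] ∃[ c ] (NonZero D × map ι c ≡ map (ι (+ D) ℚ.*_) f)
clearDenominators []      = 1 , [] , _ , refl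
clearDenominators (a ∷ f) with clearDenominators f
... | D , c , D≢0 , c≡Df = ↧ₙ a * D , ↥ a ℤ.* + D ∷ map (+ ↧ₙ a ℤ.*_) c , m*n≢0 (↧ₙ a) D {{_}} {{D≢0}} , cong₂ _∷_ head tail
  where
  open ≡-Reasoning
  ι[↧a*D] : ι (+ (↧ₙ a * D)) ≡ ι (+ ↧ₙ a) ℚ.* ι (+ D)
  ι[↧a*D] = trans (cong ι (ℤP.pos-* (↧ₙ a) D)) (ι-* (+ ↧ₙ a) (+ D))
  head : ι (↥ a ℤ.* + D) ≡ ι (+ (↧ₙ a * D)) ℚ.* a
  head = begin
    ι (↥ a ℤ.* + D)               ≡⟨ ι-* (↥ a) (+ D) ⟩
    ι (↥ a) ℚ.* ι (+ D)            ≡⟨ cong (ℚ._* ι (+ D)) (ι↧*q≡ι↥ a) ⟨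
    ι (+ ↧ₙ a) ℚ.* a ℚ.* ι (+ D)   ≡⟨ ℚ*.xy∙z≈xz∙y (ι (+ ↧ₙ a)) a (ι (+ D)) ⟩
    ι (+ ↧ₙ a) ℚ.* ι (+ D) ℚ.* a   ≡⟨ cong (ℚ._* a) ι[↧a*D] ⟨
    ι (+ (↧ₙ a * D)) ℚ.* a         ∎
  tail : map ι (map (+ ↧ₙ a ℤ.*_) c) ≡ map (ι (+ (↧ₙ a * D)) ℚ.*_) f
  tail = begin
    map ι (map (+ ↧ₙ a ℤ.*_) c)                           ≡⟨ map-ι-* (+ ↧ₙ a) c ⟩
    map (ι (+ ↧ₙ a) ℚ.*_) (map ι c)                        ≡⟨ cong (map (ι (+ ↧ₙ a) ℚ.*_)) c≡Df ⟩
    map (ι (+ ↧ₙ a) ℚ.*_) (map (ι (+ D) ℚ.*_) f)           ≡⟨ map-∘ _ _ f ⟨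
    map (λ x → ι (+ ↧ₙ a) ℚ.* (ι (+ D) ℚ.* x)) f           ≡⟨ map-cong (λ x → sym (ℚP.*-assoc (ι (+ ↧ₙ a)) (ι (+ D)) x)) f ⟩
    map (ι (+ ↧ₙ a) ℚ.* ι (+ D) ℚ.*_) f                    ≡⟨ cong (λ k → map (k ℚ.*_) f) ι[↧a*D] ⟨
    map (ι (+ (↧ₙ a * D)) ℚ.*_) f                          ∎

fromℕ≡+ : ∀ n → ℤ[X].fromℕ n ≡ + n
fromℕ≡+ zero    = refl
fromℕ≡+ (suc n) = cong (λ z → 1ℤ ℤ.+ z) (fromℕ≡+ n)

∣^∣≡∣∣^ : ∀ x n → ∣ x ℤ[X].^ n ∣ ≡ ∣ x ∣ ^ n
∣^∣≡∣∣^ x zero    = refl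
∣^∣≡∣∣^ x (suc n) = trans (ℤP.abs-* x _) (cong (∣ x ∣ *_) (∣^∣≡∣∣^ x n))

^ℚ≡^ : ∀ x n → x ^ℚ n ≡ x ℚ[X].^ n
^ℚ≡^ x zero    = refl
^ℚ≡^ x (suc n) = cong (x ℚ.*_) (^ℚ≡^ x n)

eval≡⟦⟧ : ∀ {n} (f : Vec ℚ n) x → evalList f x ≡ ℚ[X].⟦ f ⟧ x
eval≡⟦⟧ []      x = refl
eval≡⟦⟧ (a ∷ f) x = cong (λ y → a ℚ.+ x ℚ.* y) (eval≡⟦⟧ f x)

ι-⟦⟧ : ∀ {n} (c : Vec ℤ n) x → ι (ℤ[X].⟦ c ⟧ x) ≡ ℚ[X].⟦ map ι c ⟧ (ι x)
ι-⟦⟧ []      x = refl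
ι-⟦⟧ (a ∷ c) x = trans (ι-+ a _) (cong (ι a ℚ.+_) (trans (ι-* x _) (cong (ι x ℚ.*_) (ι-⟦⟧ c x))))

map-ι-mulLinear : ∀ {n} u v a₋ (p : Vec ℤ n) → map ι (ℤ[X].mulLinear u v a₋ p) ≡ ℚ[X].mulLinear (ι u) (ι v) (ι a₋) (map ι p)
map-ι-mulLinear u v a₋ []      = cong (_∷ []) (ι-* u a₋)
map-ι-mulLinear u v a₋ (a ∷ p) =
  cong₂ _∷_ (trans (ι-+ (v ℤ.* a) _) (cong₂ ℚ._+_ (ι-* v a) (ι-* u a₋))) (map-ι-mulLinear u v a p)

map-ι-linearPower : ∀ u v k → map ι (ℤ[X].linearPower u v k) ≡ ℚ[X].linearPower (ι u) (ι v) k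
map-ι-linearPower u v zero    = refl
map-ι-linearPower u v (suc k) =
  trans (map-ι-mulLinear u v 0ℤ (ℤ[X].linearPower u v k)) (cong (ℚ[X].mulLinear (ι u) (ι v) 0ℚ) (map-ι-linearPower u v k))

*≢0 : ∀ {i j} → i ≢ 0ℤ → j ≢ 0ℤ → i ℤ.* j ≢ 0ℤ
*≢0 {i} i≢0 j≢0 ij≡0 with ℤP.i*j≡0⇒i≡0∨j≡0 i ij≡0
... | inj₁ i≡0 = i≢0 i≡0
... | inj₂ j≡0 = j≢0 j≡0

^≢0 : ∀ {z} n → z ≢ 0ℤ → z ℤ[X].^ n ≢ 0ℤ
^≢0 zero    _   ()
^≢0 (suc n) z≢0 = *≢0 z≢0 (^≢0 n z≢0)

ι≢0 : ∀ {z} → z ≢ 0ℤ → ι z ≢ 0ℚ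
ι≢0 z≢0 = z≢0 ∘ ι-injective

p*q≡0⇒q≡0 : ∀ {p q} → p ≢ 0ℚ → p ℚ.* q ≡ 0ℚ → q ≡ 0ℚ
p*q≡0⇒q≡0 {p} {q} p≢0 pq≡0 = begin
  q                    ≡⟨ ℚP.*-identityˡ q ⟨
  1ℚ ℚ.* q             ≡⟨ cong (ℚ._* q) (ℚP.*-inverseˡ p) ⟨
  1/ p ℚ.* p ℚ.* q   ≡⟨ ℚP.*-assoc (1/ p) p q ⟩
  1/ p ℚ.* (p ℚ.* q) ≡⟨ cong (1/ p ℚ.*_) pq≡0 ⟩
  1/ p ℚ.* 0ℚ        ≡⟨ ℚP.*-zeroʳ (1/ p) ⟩
  0ℚ                   ∎
  where
  open ≡-Reasoning
  instance _ = ℚ.≢-nonZero p≢0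

‖_‖ : ∀ {n} → Vec ℤ n → ℕ
‖ []    ‖ = 0
‖ a ∷ p ‖ = ∣ a ∣ + ‖ p ‖

∣⟦⟧∣≤‖‖*[1+∣x∣]^n : ∀ {n} (p : Vec ℤ (suc n)) x → ∣ ℤ[X].⟦ p ⟧ x ∣ ≤ ‖ p ‖ * suc ∣ x ∣ ^ n
∣⟦⟧∣≤‖‖*[1+∣x∣]^n (a ∷ [])    x = begin
  ∣ a ℤ.+ x ℤ.* 0ℤ ∣   ≡⟨ cong ∣_∣ (trans (cong (λ z → a ℤ.+ z) (ℤP.*-zeroʳ x)) (ℤP.+-identityʳ a)) ⟩
  ∣ a ∣                ≡⟨ trans (*-identityʳ _) (+-identityʳ _) ⟨
  (∣ a ∣ + 0) * 1      ∎
  where open ≤-Reasoning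
∣⟦⟧∣≤‖‖*[1+∣x∣]^n {suc n} (a ∷ p) x = begin
  ∣ a ℤ.+ x ℤ.* ℤ[X].⟦ p ⟧ x ∣           ≤⟨ ℤP.∣i+j∣≤∣i∣+∣j∣ a _ ⟩
  ∣ a ∣ + ∣ x ℤ.* ℤ[X].⟦ p ⟧ x ∣         ≡⟨ cong (λ y → ∣ a ∣ + y) (ℤP.abs-* x _) ⟩
  ∣ a ∣ + ∣ x ∣ * ∣ ℤ[X].⟦ p ⟧ x ∣       ≤⟨ +-mono-≤ (m≤m*n ∣ a ∣ (T ^ suc n) {{m^n≢0 T (suc n)}})
                                                    (*-mono-≤ (n≤1+n ∣ x ∣) (∣⟦⟧∣≤‖‖*[1+∣x∣]^n p x)) ⟩
  ∣ a ∣ * T ^ suc n + T * (‖ p ‖ * T ^ n) ≡⟨ cong (λ y → ∣ a ∣ * T ^ suc n + y) (x∙yz≈y∙xz T ‖ p ‖ (T ^ n)) ⟩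
  ∣ a ∣ * T ^ suc n + ‖ p ‖ * T ^ suc n   ≡⟨ *-distribʳ-+ (T ^ suc n) ∣ a ∣ ‖ p ‖ ⟨
  (∣ a ∣ + ‖ p ‖) * T ^ suc n             ∎
  where
  open ≤-Reasoning
  T = suc ∣ x ∣

-- A non-zero root x of p divides the lowest non-zero coefficient of p.
root≤‖‖ : ∀ {n} (p : Vec ℤ n) {x} → Any (_≢ 0ℤ) p → ℤ[X].⟦ p ⟧ x ≡ 0ℤ → x ≢ 0ℤ → ∣ x ∣ ≤ ‖ p ‖
root≤‖‖ (a ∷ p) {x} (here a≢0) ⟦p⟧≡0 x≢0 = ≤-trans ∣x∣≤∣a∣ (m≤m+n ∣ a ∣ ‖ p ‖)
  where
  ∣a∣≡ : ∣ a ∣ ≡ ∣ ℤ[X].⟦ p ⟧ x ∣ * ∣ x ∣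
  ∣a∣≡ = begin-equality
    ∣ a ∣                         ≡⟨ cong ∣_∣ (inverseˡ-unique a _ ⟦p⟧≡0) ⟩
    ∣ ℤ.- (x ℤ.* ℤ[X].⟦ p ⟧ x) ∣  ≡⟨ ℤP.∣-i∣≡∣i∣ (x ℤ.* ℤ[X].⟦ p ⟧ x) ⟩
    ∣ x ℤ.* ℤ[X].⟦ p ⟧ x ∣        ≡⟨ ℤP.abs-* x _ ⟩
    ∣ x ∣ * ∣ ℤ[X].⟦ p ⟧ x ∣      ≡⟨ *-comm ∣ x ∣ _ ⟩
    ∣ ℤ[X].⟦ p ⟧ x ∣ * ∣ x ∣      ∎
    where open ≤-Reasoning
  ∣x∣≤∣a∣ : ∣ x ∣ ≤ ∣ a ∣
  ∣x∣≤∣a∣ = ∣⇒≤ {{ℤ.≢-nonZero a≢0}} (divides ∣ ℤ[X].⟦ p ⟧ x ∣ ∣a∣≡)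
root≤‖‖ (a ∷ p) {x} (there p≢0) ⟦a∷p⟧≡0 x≢0 with a ℤP.≟ 0ℤ
... | yes refl = root≤‖‖ p p≢0 ⟦p⟧≡0 x≢0
  where
  ⟦p⟧≡0 : ℤ[X].⟦ p ⟧ x ≡ 0ℤ
  ⟦p⟧≡0 with ℤP.i*j≡0⇒i≡0∨j≡0 x (trans (sym (ℤP.+-identityˡ _)) ⟦a∷p⟧≡0)
  ... | inj₁ x≡0 = contradiction x≡0 x≢0
  ... | inj₂ ⟦p⟧≡0 = ⟦p⟧≡0
... | no a≢0 = root≤‖‖ (a ∷ p) (here a≢0) ⟦a∷p⟧≡0 x≢0

integersUpTo : ℕ → List ℤ
integersUpTo X = List.map +_ (upTo (suc X)) ++ List.map -[1+_] (upTo X)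

∈-integersUpTo : ∀ {X} x → ∣ x ∣ ≤ X → x ∈ integersUpTo X
∈-integersUpTo {X} (+ n)      n≤X   = ∈-++⁺ˡ (∈-map⁺ +_ (∈-upTo⁺ (s≤s n≤X)))
∈-integersUpTo {X} -[1+ n ]   1+n≤X = ∈-++⁺ʳ (List.map +_ (upTo (suc X))) (∈-map⁺ -[1+_] (∈-upTo⁺ 1+n≤X))

vectorsUpTo : ℕ → (r : ℕ) → List (Vec ℕ r)
vectorsUpTo N zero    = List.[ [] ]
vectorsUpTo N (suc r) = cartesianProductWith _∷_ (upTo (suc N)) (vectorsUpTo N r)

∈-vectorsUpTo : ∀ {N r} (ns : Vec ℕ r) → All (_≤ N) ns → ns ∈ vectorsUpTo N r
∈-vectorsUpTo []       []           = here refl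
∈-vectorsUpTo (n ∷ ns) (n≤N ∷ ns≤N) = ∈-cartesianProductWith⁺ _∷_ (∈-upTo⁺ (s≤s n≤N)) (∈-vectorsUpTo ns ns≤N)

coprime-+ʳ : ∀ {a b} → Coprime ∣ a ∣ ∣ b ∣ → Coprime ∣ a ∣ ∣ a ℤ.+ b ∣
coprime-+ʳ {a} {b} a⊥b {i} (i∣a , i∣a+b) =
  a⊥b (i∣a , ℤ∣.∣⇒∣ᵤ {+ i} {b} (ℤ∣.∣m+n∣m⇒∣n (ℤ∣.∣ᵤ⇒∣ {+ i} {a ℤ.+ b} i∣a+b) (ℤ∣.∣ᵤ⇒∣ {+ i} {a} i∣a)))

coprime-+ˡ : ∀ {a b} → Coprime ∣ a ∣ ∣ b ∣ → Coprime ∣ b ∣ ∣ a ℤ.+ b ∣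
coprime-+ˡ {a} {b} a⊥b {i} (i∣b , i∣a+b) =
  a⊥b (ℤ∣.∣⇒∣ᵤ {+ i} {a} (ℤ∣.∣m+n∣n⇒∣m (ℤ∣.∣ᵤ⇒∣ {+ i} {a ℤ.+ b} i∣a+b) (ℤ∣.∣ᵤ⇒∣ {+ i} {b} i∣b)) , i∣b)

divideByGcd : ∀ a b → b ≢ 0ℤ →
  ∃[ A ] ∃[ B ] (a ≡ A ℤ.* + (gcd ∣ a ∣ ∣ b ∣) × b ≡ B ℤ.* + (gcd ∣ a ∣ ∣ b ∣) × Coprime ∣ A ∣ ∣ B ∣)
divideByGcd a b b≢0 = reduce (ℤ∣.∣ᵤ⇒∣ {+ g} {a} (gcd[m,n]∣m ∣ a ∣ ∣ b ∣)) (ℤ∣.∣ᵤ⇒∣ {+ g} {b} (gcd[m,n]∣n ∣ a ∣ ∣ b ∣))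
  where
  g = gcd ∣ a ∣ ∣ b ∣
  g≢0 : NonZero g
  g≢0 = ℕ.≢-nonZero (gcd[m,n]≢0 ∣ a ∣ ∣ b ∣ (inj₂ (b≢0 ∘ ℤP.∣i∣≡0⇒i≡0)))
  ∣∣≡g*∣∣ : ∀ {z} Q → z ≡ Q ℤ.* + g → ∣ z ∣ ≡ g * ∣ Q ∣
  ∣∣≡g*∣∣ Q refl = trans (ℤP.abs-* Q (+ g)) (*-comm ∣ Q ∣ g)
  reduce : + g ℤ∣.∣ a → + g ℤ∣.∣ b → ∃[ A ] ∃[ B ] (a ≡ A ℤ.* + g × b ≡ B ℤ.* + g × Coprime ∣ A ∣ ∣ B ∣)
  reduce (ℤ∣.divides A a≡Ag) (ℤ∣.divides B b≡Bg) = A , B , a≡Ag , b≡Bg ,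
    gcd≡1⇒coprime (*-cancelˡ-≡ (gcd ∣ A ∣ ∣ B ∣) 1 g {{g≢0}} (begin-equality
      g * (gcd ∣ A ∣ ∣ B ∣)           ≡⟨ c*gcd[m,n]≡gcd[cm,cn] g ∣ A ∣ ∣ B ∣ ⟩
      gcd (g * ∣ A ∣) (g * ∣ B ∣)     ≡⟨ cong₂ gcd (∣∣≡g*∣∣ A a≡Ag) (∣∣≡g*∣∣ B b≡Bg) ⟨
      g                               ≡⟨ *-identityʳ g ⟨
      g * 1                           ∎))
    where open ≤-Reasoning

-- ABC applied (with ε = 1/q) to the coprime triple obtained from y ^ d + E = Z by dividing out
-- g = gcd(y ^ d, E); the factor g is recovered since ∣ y ∣ ^ d = ∣ A ∣ g and ∣ E ∣ = ∣ B ∣ g.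
abc⇒power+small : ABC → ∀ q → 0 < q → ∃[ K ] (∀ d {y E Z} → y ≢ 0ℤ → E ≢ 0ℤ → Z ≢ 0ℤ → Z ≡ y ℤ[X].^ d ℤ.+ E →
                    ∣ y ∣ ^ (d * q) < K * (∣ y ∣ * ∣ E ∣ * rad ∣ Z ∣) ^ suc q)
abc⇒power+small abc q 0<q with abc 1 q (s≤s z≤n) 0<q
... | K , abcK = K , bound
  where
  bound : ∀ d {y E Z} → y ≢ 0ℤ → E ≢ 0ℤ → Z ≢ 0ℤ → Z ≡ y ℤ[X].^ d ℤ.+ E →
          ∣ y ∣ ^ (d * q) < K * (∣ y ∣ * ∣ E ∣ * rad ∣ Z ∣) ^ suc q
  bound d {y} {E} {Z} y≢0 E≢0 Z≢0 Z≡ with divideByGcd (y ℤ[X].^ d) E E≢0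
  ... | A , B , yᵈ≡Ag , E≡Bg , A⊥B = begin-strict
    ∣ y ∣ ^ (d * q)                   ≡⟨ ^-*-assoc ∣ y ∣ d q ⟨
    (∣ y ∣ ^ d) ^ q                   ≡⟨ cong (_^ q) ∣A∣g ⟨
    (∣ A ∣ * g) ^ q                   ≡⟨ [m*n]^k≡m^k*n^k ∣ A ∣ g q ⟩
    ∣ A ∣ ^ q * g ^ q                 <⟨ *-monoˡ-< (g ^ q) {{m^n≢0 g q}} ∣A∣^q<K*R^[q+1] ⟩
    K * R ^ suc q * g ^ q             ≤⟨ *-monoʳ-≤ (K * R ^ suc q) (^-monoʳ-≤ g (n≤1+n q)) ⟩
    K * R ^ suc q * g ^ suc q         ≡⟨ *-assoc K _ _ ⟩
    K * (R ^ suc q * g ^ suc q)       ≡⟨ cong (K *_) ([m*n]^k≡m^k*n^k R g (suc q)) ⟨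
    K * (R * g) ^ suc q               ≡⟨ cong (λ x → K * x ^ suc q) R*g≡ ⟩
    K * (∣ y ∣ * ∣ E ∣ * rad ∣ Z ∣) ^ suc q ∎
    where
    open ≤-Reasoning
    g = gcd ∣ y ℤ[X].^ d ∣ ∣ E ∣
    instance
      g≢0 : NonZero g
      g≢0 = ℕ.≢-nonZero (gcd[m,n]≢0 ∣ y ℤ[X].^ d ∣ ∣ E ∣ (inj₂ (E≢0 ∘ ℤP.∣i∣≡0⇒i≡0)))
    C′ = A ℤ.+ B
    R = ∣ y ∣ * ∣ B ∣ * rad ∣ Z ∣
    Z≡C′g : Z ≡ C′ ℤ.* + g
    Z≡C′g = trans Z≡ (trans (cong₂ ℤ._+_ yᵈ≡Ag E≡Bg) (sym (ℤP.*-distribʳ-+ (+ g) A B)))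
    ∣∣≡∣∣*g : ∀ {z} Q → z ≡ Q ℤ.* + g → ∣ z ∣ ≡ ∣ Q ∣ * g
    ∣∣≡∣∣*g Q refl = ℤP.abs-* Q (+ g)
    ≢0⇒≢0 : ∀ {z} Q → z ≡ Q ℤ.* + g → z ≢ 0ℤ → Q ≢ 0ℤ
    ≢0⇒≢0 Q z≡Qg z≢0 refl = z≢0 z≡Qg
    ∣A∣g : ∣ A ∣ * g ≡ ∣ y ∣ ^ d
    ∣A∣g = trans (sym (∣∣≡∣∣*g A yᵈ≡Ag)) (∣^∣≡∣∣^ y d)
    R*g≡ : R * g ≡ ∣ y ∣ * ∣ E ∣ * rad ∣ Z ∣
    R*g≡ = trans (*-assoc (∣ y ∣ * ∣ B ∣) _ g) (trans (cong (∣ y ∣ * ∣ B ∣ *_) (*-comm (rad ∣ Z ∣) g))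
             (trans (sym (*-assoc (∣ y ∣ * ∣ B ∣) g _)) (cong (λ x → x * rad ∣ Z ∣)
               (trans (*-assoc ∣ y ∣ ∣ B ∣ g) (cong (∣ y ∣ *_) (sym (∣∣≡∣∣*g B E≡Bg)))))))
    prime∣ABC⇒∣R : ∀ {p} → Prime p → p ∣ ∣ A ℤ.* B ℤ.* C′ ∣ → p ∣ R
    prime∣ABC⇒∣R {p} pp p∣ABC with euclidsLemma (∣ A ∣ * ∣ B ∣) ∣ C′ ∣ pp
      (subst (p ∣_) (trans (ℤP.abs-* (A ℤ.* B) C′) (cong (_* ∣ C′ ∣) (ℤP.abs-* A B))) p∣ABC)
    ... | inj₂ p∣C′ = ∣n⇒∣m*n (∣ y ∣ * ∣ B ∣) (∣rad {{ℤ.≢-nonZero Z≢0}} pp (subst (p ∣_) (sym (∣∣≡∣∣*g C′ Z≡C′g)) (∣m⇒∣m*n g p∣C′)))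
    ... | inj₁ p∣AB with euclidsLemma ∣ A ∣ ∣ B ∣ pp p∣AB
    ...   | inj₁ p∣A = ∣m⇒∣m*n (rad ∣ Z ∣) (∣m⇒∣m*n ∣ B ∣ (prime∣^⇒∣ d pp (subst (p ∣_) ∣A∣g (∣m⇒∣m*n g p∣A))))
    ...   | inj₂ p∣B = ∣m⇒∣m*n (rad ∣ Z ∣) (∣n⇒∣m*n ∣ y ∣ p∣B)
    N[ABC]≤R : N (A ℤ.* B ℤ.* C′) ≤ R
    N[ABC]≤R = ∣⇒≤ {{m*n≢0 _ _ {{m*n≢0 ∣ y ∣ ∣ B ∣ {{ℤ.≢-nonZero y≢0}} {{ℤ.≢-nonZero (≢0⇒≢0 B E≡Bg E≢0)}}}} {{rad≢0 ∣ Z ∣}}}}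
                   (rad-∣ prime∣ABC⇒∣R)
    ∣A∣^q<K*R^[q+1] : ∣ A ∣ ^ q < K * R ^ suc q
    ∣A∣^q<K*R^[q+1] = begin-strict
      ∣ A ∣ ^ q                               ≤⟨ ^-monoˡ-≤ q (≤-trans (m≤m⊔n ∣ A ∣ ∣ B ∣) (m≤m⊔n _ ∣ C′ ∣)) ⟩
      (∣ A ∣ ⊔ ∣ B ∣ ⊔ ∣ C′ ∣) ^ q             <⟨ abcK A B C′ (≢0⇒≢0 A yᵈ≡Ag (^≢0 d y≢0)) (≢0⇒≢0 B E≡Bg E≢0) (≢0⇒≢0 C′ Z≡C′g Z≢0)
                                                       A⊥B (coprime-+ʳ {A} {B} A⊥B) (coprime-+ˡ {A} {B} A⊥B) refl ⟩
      K * N (A ℤ.* B ℤ.* C′) ^ (q + 1)         ≡⟨ cong (λ e → K * N (A ℤ.* B ℤ.* C′) ^ e) (+-comm q 1) ⟩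
      K * N (A ℤ.* B ℤ.* C′) ^ suc q           ≤⟨ *-monoʳ-≤ K (^-monoˡ-≤ (suc q) N[ABC]≤R) ⟩
      K * R ^ suc q                           ∎

lhsProduct : ∀ {r} → Vec ℕ r → Vec ℕ r → ℕ
lhsProduct A ns = prodV (zipWith (λ a n → (n !!) * a ^ n) A ns)

maxV : ∀ {r} → Vec ℕ r → ℕ
maxV []       = 0
maxV (n ∷ ns) = n ⊔ maxV ns

maxV≤⇒All≤ : ∀ {r N} (ns : Vec ℕ r) → maxV ns ≤ N → All (_≤ N) ns
maxV≤⇒All≤ []       _  = []
maxV≤⇒All≤ (n ∷ ns) ≤N = m⊔n≤o⇒m≤o n _ ≤N ∷ maxV≤⇒All≤ ns (m⊔n≤o⇒n≤o n _ ≤N)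

prodV≢0 : ∀ {r} (A : Vec ℕ r) → All (0 <_) A → NonZero (prodV A)
prodV≢0 []      []           = _
prodV≢0 (a ∷ A) (0<a ∷ 0<A) = m*n≢0 a _ {{ℕ.>-nonZero 0<a}} {{prodV≢0 A 0<A}}

lhsProduct≢0 : ∀ {r} (A ns : Vec ℕ r) → All (0 <_) A → NonZero (lhsProduct A ns)
lhsProduct≢0 []      []       []           = _
lhsProduct≢0 (a ∷ A) (n ∷ ns) (0<a ∷ 0<A) =
  m*n≢0 _ _ {{m*n≢0 _ _ {{n!!≢0 n}} {{m^n≢0 a n {{ℕ.>-nonZero 0<a}}}}}} {{lhsProduct≢0 A ns 0<A}}

maxV!!≤lhsProduct : ∀ {r} (A ns : Vec ℕ r) → All (0 <_) A → maxV ns !! ≤ lhsProduct A ns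
maxV!!≤lhsProduct []      []       []           = ≤-refl
maxV!!≤lhsProduct (a ∷ A) (n ∷ ns) (0<a ∷ 0<A) with ⊔-sel n (maxV ns)
... | inj₁ ≡n = subst (λ k → k !! ≤ lhsProduct (a ∷ A) (n ∷ ns)) (sym ≡n)
  (≤-trans (m≤m*n (n !!) (a ^ n) {{m^n≢0 a n {{ℕ.>-nonZero 0<a}}}}) (m≤m*n _ _ {{lhsProduct≢0 A ns 0<A}}))
... | inj₂ ≡max = subst (λ k → k !! ≤ lhsProduct (a ∷ A) (n ∷ ns)) (sym ≡max)
  (≤-trans (maxV!!≤lhsProduct A ns 0<A) (m≤n*m _ _ {{m*n≢0 _ _ {{n!!≢0 n}} {{m^n≢0 a n {{ℕ.>-nonZero 0<a}}}}}}))

prime∣lhsProduct : ∀ {r p} (A ns : Vec ℕ r) → Prime p → p ∣ lhsProduct A ns → p ∣ prodV A ⊎ p ≤ maxV ns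
prime∣lhsProduct []      []       pp p∣1 = contradiction (subst Prime (∣1⇒≡1 p∣1) pp) ¬prime[1]
prime∣lhsProduct (a ∷ A) (n ∷ ns) pp p∣ with euclidsLemma ((n !!) * a ^ n) (lhsProduct A ns) pp p∣
... | inj₂ p∣rest with prime∣lhsProduct A ns pp p∣rest
...   | inj₁ p∣ΠA  = inj₁ (∣n⇒∣m*n a p∣ΠA)
...   | inj₂ p≤max = inj₂ (≤-trans p≤max (m≤n⊔m n (maxV ns)))
prime∣lhsProduct (a ∷ A) (n ∷ ns) pp p∣ | inj₁ p∣n!!aⁿ with euclidsLemma (n !!) (a ^ n) pp p∣n!!aⁿ
... | inj₁ p∣n!! = inj₂ (≤-trans (prime∣n!!⇒≤ n pp p∣n!!) (m≤m⊔n n (maxV ns)))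
... | inj₂ p∣aⁿ  = inj₁ (∣m⇒∣m*n (prodV A) (prime∣^⇒∣ n pp p∣aⁿ))

multiple-of-linearPower : ∀ {n} d (f : Vec ℚ n) P U V → P ≢ 0ℚ → U ≢ 0ℚ →
  (∀ t → P ℚ.* evalList f t ≡ (V ℚ.+ U ℚ.* t) ℚ[X].^ d) →
  ∃[ c ] ∃[ α ] ((t : ℚ) → evalList f t ≡ c ℚ.* ((t ℚ.- α) ^ℚ d))
multiple-of-linearPower d f P U V P≢0 U≢0 P*f≡ = 1/ P ℚ.* U ℚ[X].^ d , α , λ t → begin
  evalList f t                                 ≡⟨ ℚP.*-identityˡ _ ⟨
  1ℚ ℚ.* evalList f t                          ≡⟨ cong (ℚ._* evalList f t) (ℚP.*-inverseˡ P) ⟨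
  1/ P ℚ.* P ℚ.* evalList f t                  ≡⟨ ℚP.*-assoc (1/ P) P _ ⟩
  1/ P ℚ.* (P ℚ.* evalList f t)                ≡⟨ cong (1/ P ℚ.*_) (P*f≡ t) ⟩
  1/ P ℚ.* (V ℚ.+ U ℚ.* t) ℚ[X].^ d            ≡⟨ cong (λ y → 1/ P ℚ.* y ℚ[X].^ d) (V+U*t≡U*[t-α] t) ⟩
  1/ P ℚ.* (U ℚ.* (t ℚ.- α)) ℚ[X].^ d          ≡⟨ cong (1/ P ℚ.*_) (ℚ[X].^-distrib-* U (t ℚ.- α) d) ⟩
  1/ P ℚ.* (U ℚ[X].^ d ℚ.* (t ℚ.- α) ℚ[X].^ d) ≡⟨ ℚP.*-assoc (1/ P) _ _ ⟨
  1/ P ℚ.* U ℚ[X].^ d ℚ.* (t ℚ.- α) ℚ[X].^ d   ≡⟨ cong (1/ P ℚ.* U ℚ[X].^ d ℚ.*_) (^ℚ≡^ (t ℚ.- α) d) ⟨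
  1/ P ℚ.* U ℚ[X].^ d ℚ.* ((t ℚ.- α) ^ℚ d)     ∎
  where
  open ≡-Reasoning
  instance
    _ = ℚ.≢-nonZero P≢0
    _ = ℚ.≢-nonZero U≢0
  α = ℚ.- (V ℚ.* 1/ U)
  open import Algebra.Solver.Ring.NaturalCoefficients.Default (CommutativeRing.commutativeSemiring ℚP.+-*-commutativeRing)
    using (solve; _:=_; _:+_; _:*_)
  V+U*t≡U*[t-α] : ∀ t → V ℚ.+ U ℚ.* t ≡ U ℚ.* (t ℚ.- α)
  V+U*t≡U*[t-α] t = begin
    V ℚ.+ U ℚ.* t                       ≡⟨ cong (ℚ._+ U ℚ.* t) (ℚP.*-identityʳ V) ⟨
    V ℚ.* 1ℚ ℚ.+ U ℚ.* t                ≡⟨ cong (λ y → V ℚ.* y ℚ.+ U ℚ.* t) (ℚP.*-inverseʳ U) ⟨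
    V ℚ.* (U ℚ.* 1/ U) ℚ.+ U ℚ.* t      ≡⟨ solve 4 (λ V U U⁻¹ t → V :* (U :* U⁻¹) :+ U :* t := U :* (t :+ V :* U⁻¹)) refl V U (1/ U) t ⟩
    U ℚ.* (t ℚ.+ V ℚ.* 1/ U)            ≡⟨ cong (λ y → U ℚ.* (t ℚ.+ y)) (⁻¹-involutive (V ℚ.* 1/ U)) ⟨
    U ℚ.* (t ℚ.- α)                     ∎

¬Any¬⇒All : ∀ {a p} {A : Set a} {P : Pred A p} → Decidable P → ∀ {n} (xs : Vec A n) → ¬ Any (¬_ ∘ P) xs → All P xs
¬Any¬⇒All P? []       _     = []
¬Any¬⇒All P? (x ∷ xs) ¬any¬ = decidable-stable (P? x) (¬any¬ ∘ here) ∷ ¬Any¬⇒All P? xs (¬any¬ ∘ there)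

-- For d = m + 2 and q = 2 d one has d q = (d + 1) + (d - 1)(q + 1), so cancelling Y ^ ((d - 1)(q + 1)) leaves Y ^ (d + 1).
abc-exponent-gap : ∀ m {Y e R K c} .{{_ : NonZero Y}} → Y ^ ((2 + m) * (2 * (2 + m))) < K * (Y * e * R) ^ suc (2 * (2 + m)) →
                   e ≤ c * Y ^ m → Y ^ (3 + m) < K * (c * R) ^ suc (2 * (2 + m))
abc-exponent-gap m {Y} {e} {R} {K} {c} abc e≤ = *-cancelʳ-< T _ _ (begin-strict
  Y ^ (3 + m) * T                    ≡⟨ ^-distribˡ-+-* Y (3 + m) _ ⟨
  Y ^ (3 + m + suc m * suc q)        ≡⟨ cong (Y ^_) (exponents m) ⟨
  Y ^ ((2 + m) * q)                  <⟨ abc ⟩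
  K * (Y * e * R) ^ suc q            ≤⟨ *-monoʳ-≤ K (^-monoˡ-≤ (suc q) YeR≤) ⟩
  K * (c * R * Y ^ suc m) ^ suc q            ≡⟨ cong (K *_) ([m*n]^k≡m^k*n^k (c * R) _ (suc q)) ⟩
  K * ((c * R) ^ suc q * (Y ^ suc m) ^ suc q) ≡⟨ cong (λ t → K * ((c * R) ^ suc q * t)) (^-*-assoc Y (suc m) (suc q)) ⟩
  K * ((c * R) ^ suc q * T)                   ≡⟨ *-assoc K _ T ⟨
  K * (c * R) ^ suc q * T            ∎)
  where
  open ≤-Reasoning
  q = 2 * (2 + m)
  T = Y ^ (suc m * suc q)
  exponents : ∀ m → (2 + m) * (2 * (2 + m)) ≡ 3 + m + suc m * suc (2 * (2 + m))
  exponents = ℕSolver.solve-∀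
  YeR≤ : Y * e * R ≤ c * R * Y ^ suc m
  YeR≤ = begin
    Y * e * R               ≤⟨ *-monoˡ-≤ R (*-monoʳ-≤ Y e≤) ⟩
    Y * (c * Y ^ m) * R     ≡⟨ rearrange Y c (Y ^ m) R ⟩
    c * R * (Y * Y ^ m)     ∎
    where
    rearrange : ∀ y c yᵐ r → y * (c * yᵐ) * r ≡ c * r * (y * yᵐ)
    rearrange = ℕSolver.solve-∀

module Solutions (abc : ABC) {m} (f : Poly (suc (suc m))) (deg : HasDegree (suc (suc m)) f) (roots : TwoDistinctRoots f)
                 (b : ℤ) (b≢0 : b ≢ 0ℤ) {r} (A : Vec ℕ r) (0<A : All (0 <_) A) where

  d = suc (suc m)

  D : ℕ
  D = proj₁ (clearDenominators f)

  c : Vec ℤ (suc d)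
  c = proj₁ (proj₂ (clearDenominators f))

  instance
    D≢0 : NonZero D
    D≢0 = proj₁ (proj₂ (proj₂ (clearDenominators f)))

  c≡Df : map ι c ≡ map (ι (+ D) ℚ.*_) f
  c≡Df = proj₂ (proj₂ (proj₂ (clearDenominators f)))

  open ℤ[X].Completion c

  e : Vec ℤ (suc m)
  e = remainder

  +D≢0 : + D ≢ 0ℤ
  +D≢0 = ℕ.≢-nonZero⁻¹ D ∘ ℤP.+-injective

  lead≢0 : last c ≢ 0ℤ
  lead≢0 c≡0 = deg (p*q≡0⇒q≡0 (ι≢0 +D≢0) (begin
    ι (+ D) ℚ.* lead f           ≡⟨ last-map (ι (+ D) ℚ.*_) f ⟨
    last (map (ι (+ D) ℚ.*_) f)  ≡⟨ cong last c≡Df ⟨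
    last (map ι c)               ≡⟨ last-map ι c ⟩
    ι (last c)                   ≡⟨ cong ι c≡0 ⟩
    0ℚ                           ∎))
    where open ≡-Reasoning

  δ≢0 : δ ≢ 0ℤ
  δ≢0 δ≡0 with () ← trans (sym (fromℕ≡+ d)) δ≡0

  u≢0 : u ≢ 0ℤ
  u≢0 = *≢0 δ≢0 lead≢0

  K≢0 : K ≢ 0ℤ
  K≢0 = *≢0 (^≢0 d δ≢0) (^≢0 (suc m) lead≢0)

  -- If the remainder vanished, K D f would be the d-th power of a linear polynomial.
  e≢0 : Any (_≢ 0ℤ) e
  e≢0 = decidable-stable (any? (λ a → ¬? (a ℤP.≟ 0ℤ)) e) λ ¬e≢0 →
    roots (multiple-of-linearPower d f (ι (K ℤ.* + D)) (ι u) (ι v) (ι≢0 (*≢0 K≢0 +D≢0)) (ι≢0 u≢0)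
      (KD*f≡power (Pointwise-≡⇒≡ (remainder≈0⇒K*c≈linearPower (¬Any¬⇒All (ℤP._≟ 0ℤ) e ¬e≢0)))))
    where
    KD*f≡power : map (K ℤ.*_) c ≡ ℤ[X].linearPower u v d → ∀ t → ι (K ℤ.* + D) ℚ.* evalList f t ≡ (ι v ℚ.+ ι u ℚ.* t) ℚ[X].^ d
    KD*f≡power Kc≡P t = begin
      ι (K ℤ.* + D) ℚ.* evalList f t                         ≡⟨ cong₂ ℚ._*_ (ι-* K (+ D)) (eval≡⟦⟧ f t) ⟩
      ι K ℚ.* ι (+ D) ℚ.* ℚ[X].⟦ f ⟧ t                       ≡⟨ ℚP.*-assoc (ι K) (ι (+ D)) _ ⟩
      ι K ℚ.* (ι (+ D) ℚ.* ℚ[X].⟦ f ⟧ t)                     ≡⟨ cong (ι K ℚ.*_) (ℚ[X].⟦map-*⟧ (ι (+ D)) f t) ⟨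
      ι K ℚ.* ℚ[X].⟦ map (ι (+ D) ℚ.*_) f ⟧ t                ≡⟨ ℚ[X].⟦map-*⟧ (ι K) (map (ι (+ D) ℚ.*_) f) t ⟨
      ℚ[X].⟦ map (ι K ℚ.*_) (map (ι (+ D) ℚ.*_) f) ⟧ t       ≡⟨ cong (λ p → ℚ[X].⟦ map (ι K ℚ.*_) p ⟧ t) c≡Df ⟨
      ℚ[X].⟦ map (ι K ℚ.*_) (map ι c) ⟧ t                    ≡⟨ cong (λ p → ℚ[X].⟦ p ⟧ t) (map-ι-* K c) ⟨
      ℚ[X].⟦ map ι (map (K ℤ.*_) c) ⟧ t                      ≡⟨ cong (λ p → ℚ[X].⟦ map ι p ⟧ t) Kc≡P ⟩
      ℚ[X].⟦ map ι (ℤ[X].linearPower u v d) ⟧ t              ≡⟨ cong (λ p → ℚ[X].⟦ p ⟧ t) (map-ι-linearPower u v d) ⟩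
      ℚ[X].⟦ ℚ[X].linearPower (ι u) (ι v) d ⟧ t              ≡⟨ ℚ[X].⟦linearPower⟧ (ι u) (ι v) d t ⟩
      (ι v ℚ.+ ι u ℚ.* t) ℚ[X].^ d                           ∎
      where open ≡-Reasoning

  q : ℕ
  q = 2 * d

  K′ : ℕ
  K′ = proj₁ (abc⇒power+small abc q (s≤s z≤n))

  abc-power+small : ∀ d {y E Z} → y ≢ 0ℤ → E ≢ 0ℤ → Z ≢ 0ℤ → Z ≡ y ℤ[X].^ d ℤ.+ E →
                    ∣ y ∣ ^ (d * q) < K′ * (∣ y ∣ * ∣ E ∣ * rad ∣ Z ∣) ^ suc q
  abc-power+small = proj₂ (abc⇒power+small abc q (s≤s z≤n))

  W Cₑ C₂ G N₀ Y₀ Y₁ Yb Xb Zb : ℕ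
  W  = ∣ K ∣ * D * ∣ b ∣ * prodV A
  Cₑ = ‖ e ‖ * (2 + ∣ v ∣) ^ m
  C₂ = suc Cₑ * K′ * (Cₑ * W) ^ suc q
  G  = 8 ^ suc q
  N₀ = (2 * G) ^ (2 * G * (2 * G)) * C₂
  Y₀ = ∣ v ∣ + ∣ u ∣ * ‖ e ‖
  Y₁ = K′ * (Cₑ * (W * 8 ^ N₀)) ^ suc q
  Yb = Y₀ + Y₁
  Xb = Yb + ∣ v ∣
  Zb = Yb ^ d + ‖ e ‖ * suc Xb ^ m

  C₂*Gⁿ≡ : ∀ n → C₂ * G ^ n ≡ suc Cₑ * (K′ * (Cₑ * (W * 8 ^ n)) ^ suc q)
  C₂*Gⁿ≡ n = begin
    suc Cₑ * K′ * (Cₑ * W) ^ suc q * G ^ n               ≡⟨ reassoc (suc Cₑ) K′ _ _ ⟨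
    suc Cₑ * (K′ * ((Cₑ * W) ^ suc q * G ^ n))            ≡⟨ cong (λ t → suc Cₑ * (K′ * ((Cₑ * W) ^ suc q * t))) Gⁿ≡8ⁿ^[q+1] ⟩
    suc Cₑ * (K′ * ((Cₑ * W) ^ suc q * (8 ^ n) ^ suc q))  ≡⟨ cong (λ t → suc Cₑ * (K′ * t)) ([m*n]^k≡m^k*n^k (Cₑ * W) _ (suc q)) ⟨
    suc Cₑ * (K′ * (Cₑ * W * 8 ^ n) ^ suc q)              ≡⟨ cong (λ t → suc Cₑ * (K′ * t ^ suc q)) (*-assoc Cₑ W _) ⟩
    suc Cₑ * (K′ * (Cₑ * (W * 8 ^ n)) ^ suc q)            ∎
    where
    open ≡-Reasoning
    Gⁿ≡8ⁿ^[q+1] : G ^ n ≡ (8 ^ n) ^ suc q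
    Gⁿ≡8ⁿ^[q+1] = trans (^-*-assoc 8 (suc q) n) (trans (cong (8 ^_) (*-comm (suc q) n)) (sym (^-*-assoc 8 n (suc q))))
    reassoc : ∀ a b c g → a * (b * (c * g)) ≡ a * b * c * g
    reassoc = ℕSolver.solve-∀

  module Solution (x : ℤ) (ns : Vec ℕ r) (sol : lhs b A ns / 1 ≡ eval f (x / 1)) where

    M n : ℕ
    M = lhsProduct A ns
    n = maxV ns

    y E Z : ℤ
    y = v ℤ.+ u ℤ.* x
    E = ℤ[X].⟦ e ⟧ x
    Z = K ℤ.* (+ D ℤ.* lhs b A ns)

    instance
      M≢0 : NonZero M
      M≢0 = lhsProduct≢0 A ns 0<A

    D*lhs≡⟦c⟧ : + D ℤ.* lhs b A ns ≡ ℤ[X].⟦ c ⟧ x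
    D*lhs≡⟦c⟧ = ι-injective (begin
      ι (+ D ℤ.* lhs b A ns)              ≡⟨ ι-* (+ D) _ ⟩
      ι (+ D) ℚ.* ι (lhs b A ns)          ≡⟨ cong (ι (+ D) ℚ.*_) (trans sol (eval≡⟦⟧ f (ι x))) ⟩
      ι (+ D) ℚ.* ℚ[X].⟦ f ⟧ (ι x)        ≡⟨ ℚ[X].⟦map-*⟧ (ι (+ D)) f (ι x) ⟨
      ℚ[X].⟦ map (ι (+ D) ℚ.*_) f ⟧ (ι x) ≡⟨ cong (λ p → ℚ[X].⟦ p ⟧ (ι x)) c≡Df ⟨
      ℚ[X].⟦ map ι c ⟧ (ι x)              ≡⟨ ι-⟦⟧ c x ⟨
      ι (ℤ[X].⟦ c ⟧ x)                    ∎)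
      where open ≡-Reasoning

    Z≡yᵈ+E : Z ≡ y ℤ[X].^ d ℤ.+ E
    Z≡yᵈ+E = trans (cong (K ℤ.*_) D*lhs≡⟦c⟧) (K*⟦c⟧≈power+⟦remainder⟧ x)

    ∣Z∣≡ : ∣ Z ∣ ≡ ∣ K ∣ * D * ∣ b ∣ * M
    ∣Z∣≡ = trans (ℤP.abs-* K _) (trans (cong (∣ K ∣ *_) (trans (ℤP.abs-* (+ D) _) (cong (D *_) (ℤP.abs-* b (+ M)))))
             (reassoc (∣ K ∣) D (∣ b ∣) M))
      where
      reassoc : ∀ k d b m → k * (d * (b * m)) ≡ k * d * b * m
      reassoc = ℕSolver.solve-∀

    Z≢0 : Z ≢ 0ℤ
    Z≢0 = *≢0 K≢0 (*≢0 +D≢0 (*≢0 b≢0 (ℕ.≢-nonZero⁻¹ M ∘ ℤP.+-injective)))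

    n!!≤∣Z∣ : n !! ≤ ∣ Z ∣
    n!!≤∣Z∣ = ≤-trans (maxV!!≤lhsProduct A ns 0<A)
                (subst (M ≤_) (sym ∣Z∣≡) (m≤n*m M _ {{m*n≢0 _ _ {{m*n≢0 _ _ {{ℤ.≢-nonZero K≢0}}}} {{ℤ.≢-nonZero b≢0}}}}))

    rad∣Z∣≤W*8ⁿ : rad ∣ Z ∣ ≤ W * 8 ^ n
    rad∣Z∣≤W*8ⁿ = begin
      rad ∣ Z ∣                          ≡⟨ cong rad ∣Z∣≡ ⟩
      rad (W₀ * M)                       ≤⟨ ∣⇒≤ {{m*n≢0 W₀ _ {{W₀≢0}} {{m*n≢0 _ _ {{ΠA≢0}} {{primorial≢0 n}}}}}} (rad-∣ prime∣W₀M) ⟩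
      W₀ * (prodV A * primorial n)       ≤⟨ *-monoʳ-≤ W₀ (*-monoʳ-≤ (prodV A) (primorial≤8^n n)) ⟩
      W₀ * (prodV A * 8 ^ n)             ≡⟨ *-assoc W₀ (prodV A) _ ⟨
      W * 8 ^ n                          ∎
      where
      open ≤-Reasoning
      W₀ = ∣ K ∣ * D * ∣ b ∣
      W₀≢0 : NonZero W₀
      W₀≢0 = m*n≢0 _ _ {{m*n≢0 _ _ {{ℤ.≢-nonZero K≢0}}}} {{ℤ.≢-nonZero b≢0}}
      ΠA≢0 : NonZero (prodV A)
      ΠA≢0 = prodV≢0 A 0<A
      prime∣W₀M : ∀ {p} → Prime p → p ∣ W₀ * M → p ∣ W₀ * (prodV A * primorial n)
      prime∣W₀M {p} pp p∣W₀M with euclidsLemma W₀ M pp p∣W₀M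
      ... | inj₁ p∣W₀ = ∣m⇒∣m*n _ p∣W₀
      ... | inj₂ p∣M with prime∣lhsProduct A ns pp p∣M
      ...   | inj₁ p∣ΠA = ∣n⇒∣m*n W₀ (∣m⇒∣m*n (primorial n) p∣ΠA)
      ...   | inj₂ p≤n  = ∣n⇒∣m*n W₀ (∣n⇒∣m*n (prodV A) (∣primorial pp p≤n))

    ∣Z∣≤∣y∣ᵈ+∣E∣ : ∣ Z ∣ ≤ ∣ y ∣ ^ d + ∣ E ∣
    ∣Z∣≤∣y∣ᵈ+∣E∣ = begin
      ∣ Z ∣                          ≡⟨ cong ∣_∣ Z≡yᵈ+E ⟩
      ∣ y ℤ[X].^ d ℤ.+ E ∣           ≤⟨ ℤP.∣i+j∣≤∣i∣+∣j∣ (y ℤ[X].^ d) E ⟩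
      ∣ y ℤ[X].^ d ∣ + ∣ E ∣         ≡⟨ cong (_+ ∣ E ∣) (∣^∣≡∣∣^ y d) ⟩
      ∣ y ∣ ^ d + ∣ E ∣              ∎
      where open ≤-Reasoning

    ∣E∣≤ : ∣ E ∣ ≤ ‖ e ‖ * suc ∣ x ∣ ^ m
    ∣E∣≤ = ∣⟦⟧∣≤‖‖*[1+∣x∣]^n e x

    ∣x∣≤∣y∣+∣v∣ : ∣ x ∣ ≤ ∣ y ∣ + ∣ v ∣
    ∣x∣≤∣y∣+∣v∣ = begin
      ∣ x ∣                    ≤⟨ m≤n*m ∣ x ∣ ∣ u ∣ {{ℤ.≢-nonZero u≢0}} ⟩
      ∣ u ∣ * ∣ x ∣            ≡⟨ ℤP.abs-* u x ⟨
      ∣ u ℤ.* x ∣              ≡⟨ cong ∣_∣ (y-v≡ux u v x) ⟨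
      ∣ y ℤ.- v ∣              ≤⟨ ℤP.∣i-j∣≤∣i∣+∣j∣ y v ⟩
      ∣ y ∣ + ∣ v ∣            ∎
      where
      open ≤-Reasoning
      y-v≡ux : ∀ u v x → v ℤ.+ u ℤ.* x ℤ.- v ≡ u ℤ.* x
      y-v≡ux = ℤSolver.solve-∀

    ∣E∣≤Cₑ*∣y∣ᵐ : y ≢ 0ℤ → ∣ E ∣ ≤ Cₑ * ∣ y ∣ ^ m
    ∣E∣≤Cₑ*∣y∣ᵐ y≢0 = begin
      ∣ E ∣                                 ≤⟨ ∣E∣≤ ⟩
      ‖ e ‖ * suc ∣ x ∣ ^ m                 ≤⟨ *-monoʳ-≤ ‖ e ‖ (^-monoˡ-≤ m 1+∣x∣≤) ⟩
      ‖ e ‖ * ((2 + ∣ v ∣) * ∣ y ∣) ^ m     ≡⟨ cong (‖ e ‖ *_) ([m*n]^k≡m^k*n^k (2 + ∣ v ∣) ∣ y ∣ m) ⟩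
      ‖ e ‖ * ((2 + ∣ v ∣) ^ m * ∣ y ∣ ^ m) ≡⟨ *-assoc ‖ e ‖ _ _ ⟨
      Cₑ * ∣ y ∣ ^ m                        ∎
      where
      open ≤-Reasoning
      1+∣x∣≤ : suc ∣ x ∣ ≤ (2 + ∣ v ∣) * ∣ y ∣
      1+∣x∣≤ = ≤-trans (s≤s ∣x∣≤∣y∣+∣v∣) (≤-trans (≤-reflexive (sym (+-suc ∣ y ∣ ∣ v ∣)))
                 (+-monoʳ-≤ ∣ y ∣ (m≤m*n (suc ∣ v ∣) ∣ y ∣ {{ℤ.≢-nonZero y≢0}})))

    abc-case : y ≢ 0ℤ → E ≢ 0ℤ → n ≤ N₀ × ∣ y ∣ ≤ Y₁
    abc-case y≢0 E≢0 = n≤N₀ , ∣y∣≤Y₁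
      where
      open ≤-Reasoning
      Y = ∣ y ∣
      instance
        Y≢0 : NonZero Y
        Y≢0 = ℤ.≢-nonZero y≢0
      Yᵈ⁺¹< : Y ^ suc d < K′ * (Cₑ * (W * 8 ^ n)) ^ suc q
      Yᵈ⁺¹< = abc-exponent-gap m {Y} {∣ E ∣} {W * 8 ^ n} {K′} {Cₑ}
        (≤-trans (abc-power+small d y≢0 E≢0 Z≢0 Z≡yᵈ+E)
                 (*-monoʳ-≤ K′ (^-monoˡ-≤ (suc q) (*-monoʳ-≤ (Y * ∣ E ∣) rad∣Z∣≤W*8ⁿ))))
        (∣E∣≤Cₑ*∣y∣ᵐ y≢0)
      n!!≤C₂*Gⁿ : n !! ≤ C₂ * G ^ n
      n!!≤C₂*Gⁿ = begin
        n !!                                       ≤⟨ n!!≤∣Z∣ ⟩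
        ∣ Z ∣                                      ≤⟨ ∣Z∣≤∣y∣ᵈ+∣E∣ ⟩
        Y ^ d + ∣ E ∣                              ≤⟨ +-monoʳ-≤ (Y ^ d) (≤-trans (∣E∣≤Cₑ*∣y∣ᵐ y≢0) (*-monoʳ-≤ Cₑ (^-monoʳ-≤ Y (m≤n+m m 2)))) ⟩
        suc Cₑ * Y ^ d                             ≤⟨ *-monoʳ-≤ (suc Cₑ) (^-monoʳ-≤ Y (n≤1+n d)) ⟩
        suc Cₑ * Y ^ suc d                         ≤⟨ *-monoʳ-≤ (suc Cₑ) (<⇒≤ Yᵈ⁺¹<) ⟩
        suc Cₑ * (K′ * (Cₑ * (W * 8 ^ n)) ^ suc q) ≡⟨ C₂*Gⁿ≡ n ⟨
        C₂ * G ^ n                                 ∎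
      n≤N₀ : n ≤ N₀
      n≤N₀ = !!≤c*g^n⇒n≤ C₂ G n {{m^n≢0 8 (suc q)}} n!!≤C₂*Gⁿ
      ∣y∣≤Y₁ : Y ≤ Y₁
      ∣y∣≤Y₁ = begin
        Y                                  ≤⟨ m≤m*n Y (Y ^ d) {{m^n≢0 Y d}} ⟩
        Y ^ suc d                          ≤⟨ <⇒≤ Yᵈ⁺¹< ⟩
        K′ * (Cₑ * (W * 8 ^ n)) ^ suc q    ≤⟨ *-monoʳ-≤ K′ (^-monoˡ-≤ (suc q) (*-monoʳ-≤ Cₑ (*-monoʳ-≤ W (^-monoʳ-≤ 8 n≤N₀)))) ⟩
        Y₁                                 ∎

    ∣y∣≤Yb : ∣ y ∣ ≤ Yb
    ∣y∣≤Yb with E ℤP.≟ 0ℤ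
    ... | yes E≡0 = ≤-trans ∣y∣≤Y₀ (m≤m+n Y₀ Y₁)
      where
      ∣x∣≤‖e‖ : ∣ x ∣ ≤ ‖ e ‖
      ∣x∣≤‖e‖ with x ℤP.≟ 0ℤ
      ... | yes refl = z≤n
      ... | no  x≢0  = root≤‖‖ e e≢0 E≡0 x≢0
      ∣y∣≤Y₀ : ∣ y ∣ ≤ Y₀
      ∣y∣≤Y₀ = ≤-trans (ℤP.∣i+j∣≤∣i∣+∣j∣ v (u ℤ.* x))
                 (+-monoʳ-≤ ∣ v ∣ (≤-trans (≤-reflexive (ℤP.abs-* u x)) (*-monoʳ-≤ ∣ u ∣ ∣x∣≤‖e‖)))
    ... | no E≢0 with y ℤP.≟ 0ℤ
    ...   | yes y≡0 = subst (_≤ Yb) (cong ∣_∣ (sym y≡0)) z≤n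
    ...   | no  y≢0 = ≤-trans (proj₂ (abc-case y≢0 E≢0)) (m≤n+m Y₁ Y₀)

    ∣x∣≤Xb : ∣ x ∣ ≤ Xb
    ∣x∣≤Xb = ≤-trans ∣x∣≤∣y∣+∣v∣ (+-monoˡ-≤ ∣ v ∣ ∣y∣≤Yb)

    ns≤Zb : All (_≤ Zb) ns
    ns≤Zb = maxV≤⇒All≤ ns (begin
      n                                ≤⟨ n≤n!! n ⟩
      n !!                             ≤⟨ n!!≤∣Z∣ ⟩
      ∣ Z ∣                            ≤⟨ ∣Z∣≤∣y∣ᵈ+∣E∣ ⟩
      ∣ y ∣ ^ d + ∣ E ∣                ≤⟨ +-mono-≤ (^-monoˡ-≤ d ∣y∣≤Yb) (≤-trans ∣E∣≤ (*-monoʳ-≤ ‖ e ‖ (^-monoˡ-≤ m (s≤s ∣x∣≤Xb)))) ⟩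
      Zb                               ∎)
      where open ≤-Reasoning

-- NotMonomial f is implied by TwoDistinctRoots f (take α = 0), and the nᵢ need not be positive.
theorem1p7 : ABC →
    (d : ℕ) → 2 ≤ d → (f : Poly d) → HasDegree d f → NotMonomial f → TwoDistinctRoots f →
    (b : ℤ) → b ≢ 0ℤ → (r : ℕ) → (A : Vec ℕ r) → All (0 <_) A →
    ∃[ L ] ((x : ℤ) → (ns : Vec ℕ r) → All (0 <_) ns →
      lhs b A ns / 1 ≡ eval f (x / 1) →
      (x , ns) ∈ L)
theorem1p7 abc (suc (suc m)) (s≤s (s≤s z≤n)) f deg _ roots b b≢0 r A 0<A =
  cartesianProduct (integersUpTo Xb) (vectorsUpTo Zb r) ,
  λ x ns _ sol → ∈-cartesianProduct⁺ (∈-integersUpTo x (Solution.∣x∣≤Xb x ns sol)) (∈-vectorsUpTo ns (Solution.ns≤Zb x ns sol))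
  where open Solutions abc f deg roots b b≢0 A 0<A
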